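{- Let $p\equiv 1\pmod 4$ be a prime. Then $$\prod_{\substack{1\le i<j\le (p-1)/2\\ i^2+j^2\equiv 0\pmod p}}(j^2-i^2)\equiv \prod_{a\in V}(\overline{a}^2-a^2)\equiv \left(\frac{2}{p}\right)\prod_{x=1}^{(p-1)/2}x \pmod p,$$ where $\left(\frac{2}{p}\right)$ is the Legendre symbol.
   Context: For an integer $x$, $\{x\}_p$ denotes the least nonnegative residue of $x$ modulo $p$, and $\widetilde{x}=p-\{x\}_p$ if $\{x\}_p>p/2$, while $\widetilde{x}=\{x\}_p$ if $\{x\}_p<p/2$. Let $t=\prod_{x=1}^{(p-1)/2}x$. Let $V=\{x : 1\le x\le (p-1)/2,\ x<\widetilde{tx}\}$, and for $a\in V$ put $\overline{a}=\widetilde{ta}$. -}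

module Defs where

open import Data.Nat using (ℕ; zero; suc; _+_; _*_; _∸_; _<ᵇ_; _≡ᵇ_; _%_; _/_; NonZero)
open import Data.Bool using (Bool; true; false; if_then_else_)
open import Data.List using (List; map; upTo; filterᵇ; concatMap)
open import Data.Nat.ListAction using (product)
open import Data.Bool.ListAction using (any)
open import Data.Product using (_×_; _,_; proj₁; proj₂)
open import Data.Integer as ℤ using (ℤ; +_; -_; _-_)
open import Data.Integer.Divisibility as ℤD using ()

half : ℕ → ℕ
half p = (p ∸ 1) / 2

range1 : ℕ → List ℕ
range1 n = map suc (upTo n)

res : (p : ℕ) → .{{NonZero p}} → ℕ → ℕ
res p x = x % p

tilde : (p : ℕ) → .{{NonZero p}} → ℕ → ℕ
tilde p x = if p <ᵇ 2 * res p x then p ∸ res p x else res p x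

tval : ℕ → ℕ
tval p = product (range1 (half p))

Vset : (p : ℕ) → .{{NonZero p}} → List ℕ
Vset p = filterᵇ (λ x → x <ᵇ tilde p (tval p * x)) (range1 (half p))

bar : (p : ℕ) → .{{NonZero p}} → ℕ → ℕ
bar p a = tilde p (tval p * a)

pairs : (p : ℕ) → .{{NonZero p}} → List (ℕ × ℕ)
pairs p = filterᵇ (λ ij → ((proj₁ ij * proj₁ ij + proj₂ ij * proj₂ ij) % p) ≡ᵇ 0)
                  (concatMap (λ j → map (λ i → (i , j)) (range1 (j ∸ 1))) (range1 (half p)))

-- ∏ (j² - i²) over the pairs (nonnegative since i < j)
prodPairs : (p : ℕ) → .{{NonZero p}} → ℕ
prodPairs p = product (map (λ ij → proj₂ ij * proj₂ ij ∸ proj₁ ij * proj₁ ij) (pairs p))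

-- ∏_{a ∈ V} (ā² - a²) (nonnegative since a < ā)
prodV : (p : ℕ) → .{{NonZero p}} → ℕ
prodV p = product (map (λ a → bar p a * bar p a ∸ a * a) (Vset p))

legendre : ℕ → (p : ℕ) → .{{NonZero p}} → ℤ
legendre a p =
  if (a % p) ≡ᵇ 0 then + 0
  else if any (λ x → ((x * x) % p) ≡ᵇ (a % p)) (upTo p) then + 1
  else - (+ 1)

_≡_[mod_] : ℤ → ℤ → ℕ → Set
a ≡ b [mod p ] = (+ p) ℤD.∣ (a - b)

-- Let t = ((p-1)/2)!.  Wilson's theorem and p ≡ 1 (mod 4) give t² ≡ -1, so ā ≡ ±t·a and
-- a ↦ ā is a fixed-point-free involution of {1, …, (p-1)/2}.  For i, j in that range,
-- p ∣ i² + j² forces i = j̄, so both products run over the same pairs {a, ā} and are equal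
-- as natural numbers.
-- For the second congruence put s(y) = (-1)^y·y; then s(y) ≡ s(ỹ) for y < p, and
-- ā² - a² = s(ā - a)·s(ā + a).  Multiplication by 1 + t sends {a, ā} to ±{ā + a, ā - a},
-- hence ∏_{a∈V} (ā² - a²) ≡ ∏_y s((1+t)y)~ ≡ ∏_y s(y), y ↦ (cy)~ being a permutation of the
-- half system for c ≢ 0.  With c = 2 the same argument (Gauss' lemma) gives ∏_y s(y) ≡ 2^((p-1)/2)·t,
-- and Euler's criterion turns 2^((p-1)/2) into (2/p).  All permutations used are composites of
-- the involutions x ↦ c/x, so products are only ever reindexed along involutions.

module Submission where

open import Defs
open import Data.Nat using (ℕ; _%_; NonZero)
open import Data.Nat.Primality using (Prime)
open import Data.Integer using (+_; _*_)
open import Data.Product using (_×_)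
open import Relation.Binary.PropositionalEquality using (_≡_)

open import Algebra.Bundles using (CommutativeMonoid)
open import Data.Bool using (Bool; true; false; if_then_else_; T)
open import Data.Bool.Properties using (T-≡)
open import Data.Bool.ListAction using (any)
open import Data.Empty using (⊥-elim)
open import Data.Integer as ℤ using (ℤ; -_; _-_; _^_; -1ℤ)
import Data.Integer.DivMod as ℤ
import Data.Integer.Divisibility.Signed as ℤ
import Data.Integer.Properties as ℤ
open import Data.Integer.Tactic.RingSolver using (solve-∀)
open import Data.List using (List; upTo)
open import Data.List.Membership.Propositional using (lose)
open import Data.List.Membership.Propositional.Properties using (∈-upTo⁺)
import Data.List.Relation.Unary.Any as Any
open import Data.List.Relation.Unary.Any.Properties using (any⁺; any⁻)
open import Data.Nat as ℕ using (zero; suc; _∸_; _/_; _≤_; _<_; z≤n; s≤s; _<ᵇ_; _≡ᵇ_)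
import Data.Nat.DivMod as DivMod
import Data.Nat.Divisibility as ℕ
open import Data.Nat.GCD using (module Bézout; module GCD; GCD)
import Data.Nat.Primality as Prime
import Data.Nat.Properties as ℕ
import Data.Nat.Tactic.RingSolver as ℕSolver
open import Data.Product using (_,_; proj₁; proj₂)
open import Data.Sum as Sum using (_⊎_; inj₁; inj₂; [_,_]′)
open import Data.Unit using (tt)
open import Function.Bundles using (_⇔_; mk⇔; Equivalence)
open import Relation.Binary.Bundles using (Setoid)
open import Relation.Binary.Definitions using (tri<; tri≈; tri>)
open import Relation.Binary.PropositionalEquality as ≡ using (_≢_; refl; cong)
import Relation.Binary.Reasoning.Setoid
open import Relation.Nullary using (¬_; Dec; yes; no)
open import Relation.Nullary.Decidable using (T?)

if-T : ∀ {a} {A : Set a} {b : Bool} {x y : A} → T b → (if b then x else y) ≡ x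
if-T {b = true} _ = refl

if-¬T : ∀ {a} {A : Set a} {b : Bool} {x y : A} → ¬ T b → (if b then x else y) ≡ y
if-¬T {b = true} ¬t = ⊥-elim (¬t tt)
if-¬T {b = false} _ = refl

if-< : ∀ {a} {A : Set a} {m n} {x y : A} → m < n → (if m <ᵇ n then x else y) ≡ x
if-< m<n = if-T (ℕ.<⇒<ᵇ m<n)

if-≮ : ∀ {a} {A : Set a} {m n} {x y : A} → ¬ m < n → (if m <ᵇ n then x else y) ≡ y
if-≮ {m = m} {n} m≮n = if-¬T (λ t → m≮n (ℕ.<ᵇ⇒< m n t))

if-≡ᵇ-refl : ∀ {a} {A : Set a} m {x y : A} → (if m ≡ᵇ m then x else y) ≡ x
if-≡ᵇ-refl m = if-T (ℕ.≡⇒≡ᵇ m m refl)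

if-≢ : ∀ {a} {A : Set a} {m n} {x y : A} → m ≢ n → (if m ≡ᵇ n then x else y) ≡ y
if-≢ {m = m} {n} m≢n = if-¬T (λ t → m≢n (ℕ.≡ᵇ⇒≡ m n t))

¬T⇒≡false : ∀ {b} → ¬ T b → b ≡ false
¬T⇒≡false {true} ¬t = ⊥-elim (¬t tt)
¬T⇒≡false {false} _ = refl

count : ℕ → (ℕ → Bool) → ℕ
count zero b = zero
count (suc n) b = if b (suc n) then suc (count n b) else count n b

record IsInvolutionOn (n : ℕ) (σ : ℕ → ℕ) : Set where
  field
    closed : ∀ x → 1 ≤ x → x ≤ n → 1 ≤ σ x × σ x ≤ n
    involutive : ∀ x → 1 ≤ x → x ≤ n → σ (σ x) ≡ x

dropCycle : (ℕ → ℕ) → ℕ → ℕ → ℕ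
dropCycle σ s x = if x ≡ᵇ σ s then σ s else σ x

module _ {n σ} (σ-inv : IsInvolutionOn (suc n) σ) where

  open IsInvolutionOn σ-inv

  private
    closed′ : ∀ {x} → 1 ≤ x → x ≤ n → 1 ≤ σ x × σ x ≤ suc n
    closed′ {x} 1≤x x≤n = closed x 1≤x (ℕ.m≤n⇒m≤1+n x≤n)

    involutive′ : ∀ {x} → 1 ≤ x → x ≤ n → σ (σ x) ≡ x
    involutive′ {x} 1≤x x≤n = involutive x 1≤x (ℕ.m≤n⇒m≤1+n x≤n)

    σ-into : ∀ {x y} → 1 ≤ x → x ≤ n → σ x ≡ y → x ≡ σ y
    σ-into 1≤x x≤n σx≡y = ≡.trans (≡.sym (involutive′ 1≤x x≤n)) (cong σ σx≡y)

    σ-top : σ (σ (suc n)) ≡ suc n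
    σ-top = involutive (suc n) (s≤s z≤n) ℕ.≤-refl

  restrictInvolution : σ (suc n) ≡ suc n → IsInvolutionOn n σ
  restrictInvolution σs≡s = record
    { closed = λ x 1≤x x≤n → proj₁ (closed′ 1≤x x≤n) , ℕ.≤-pred (ℕ.≤∧≢⇒< (proj₂ (closed′ 1≤x x≤n))
        (λ σx≡s → ℕ.<⇒≢ (s≤s x≤n) (≡.trans (σ-into 1≤x x≤n σx≡s) σs≡s)))
    ; involutive = λ x 1≤x x≤n → involutive′ 1≤x x≤n }

  dropCycle-involution : σ (suc n) ≢ suc n → IsInvolutionOn n (dropCycle σ (suc n))
  dropCycle-involution σs≢s = record { closed = τ-closed ; involutive = τ-involutive }
    where
    k = σ (suc n)
    τ = dropCycle σ (suc n)
    k-range : 1 ≤ k × k ≤ n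
    k-range = proj₁ (closed (suc n) (s≤s z≤n) ℕ.≤-refl) , ℕ.≤-pred (ℕ.≤∧≢⇒< (proj₂ (closed (suc n) (s≤s z≤n) ℕ.≤-refl)) σs≢s)
    τ-closed : ∀ x → 1 ≤ x → x ≤ n → 1 ≤ τ x × τ x ≤ n
    τ-closed x 1≤x x≤n with x ℕ.≟ k
    ... | yes refl = ≡.subst (λ y → 1 ≤ y × y ≤ n) (≡.sym (if-≡ᵇ-refl k)) k-range
    ... | no x≢k = ≡.subst (λ y → 1 ≤ y × y ≤ n) (≡.sym (if-≢ x≢k))
          (proj₁ (closed′ 1≤x x≤n) , ℕ.≤-pred (ℕ.≤∧≢⇒< (proj₂ (closed′ 1≤x x≤n)) (λ σx≡s → x≢k (σ-into 1≤x x≤n σx≡s))))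
    τ-involutive : ∀ x → 1 ≤ x → x ≤ n → τ (τ x) ≡ x
    τ-involutive x 1≤x x≤n with x ℕ.≟ k
    ... | yes refl = ≡.trans (cong τ (if-≡ᵇ-refl k)) (if-≡ᵇ-refl k)
    ... | no x≢k = ≡.trans (cong τ (if-≢ x≢k)) (≡.trans (if-≢ σx≢k) (involutive′ 1≤x x≤n))
      where
      σx≢k : σ x ≢ k
      σx≢k σx≡k = ℕ.<⇒≢ (s≤s x≤n) (≡.trans (σ-into 1≤x x≤n σx≡k) σ-top)

module RangeProduct {c ℓ} (M : CommutativeMonoid c ℓ) where

  open import Data.Nat using (_+_)
  open CommutativeMonoid M renaming (Carrier to C; refl to ≈-refl; sym to ≈-sym; trans to ≈-trans)
  open import Algebra.Properties.CommutativeSemigroup commutativeSemigroup using (interchange; x∙yz≈y∙xz)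
  open import Relation.Binary.Reasoning.Setoid setoid

  Π : ℕ → (ℕ → C) → C
  Π zero f = ε
  Π (suc n) f = f (suc n) ∙ Π n f

  Π-cong : ∀ n {f g : ℕ → C} → (∀ x → 1 ≤ x → x ≤ n → f x ≈ g x) → Π n f ≈ Π n g
  Π-cong zero f≈g = ≈-refl
  Π-cong (suc n) f≈g = ∙-cong (f≈g (suc n) (s≤s z≤n) ℕ.≤-refl)
                              (Π-cong n (λ x 1≤x x≤n → f≈g x 1≤x (ℕ.m≤n⇒m≤1+n x≤n)))

  Π-distrib : ∀ n (f g : ℕ → C) → Π n (λ x → f x ∙ g x) ≈ Π n f ∙ Π n g
  Π-distrib zero f g = ≈-sym (identityˡ ε)
  Π-distrib (suc n) f g = ≈-trans (∙-congˡ (Π-distrib n f g)) (interchange _ _ _ _)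

  Π-+ : ∀ n m (f : ℕ → C) → Π (n + m) f ≈ Π m f ∙ Π n (λ x → f (m + x))
  Π-+ zero m f = ≈-sym (identityʳ _)
  Π-+ (suc n) m f = begin
    f (suc (n + m)) ∙ Π (n + m) f                   ≈⟨ ∙-cong (reflexive (cong f (ℕ.+-comm (suc n) m))) (Π-+ n m f) ⟩
    f (m + suc n) ∙ (Π m f ∙ Π n (λ x → f (m + x))) ≈⟨ x∙yz≈y∙xz _ _ _ ⟩
    Π m f ∙ (f (m + suc n) ∙ Π n (λ x → f (m + x))) ∎

  Π-single : ∀ n k (a : C) → 1 ≤ k → Π n (λ x → if x ≡ᵇ k then a else ε) ≈ (if k <ᵇ suc n then a else ε)
  Π-single zero k a 1≤k = reflexive (≡.sym (if-≮ (λ k<1 → ℕ.<⇒≱ k<1 1≤k)))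
  Π-single (suc n) k a 1≤k with ℕ.<-cmp k (suc n)
  ... | tri< k<1+n _ _ = begin
    (if suc n ≡ᵇ k then a else ε) ∙ Π n (λ x → if x ≡ᵇ k then a else ε)
      ≈⟨ ∙-cong (reflexive (if-≢ (ℕ.>⇒≢ k<1+n))) (Π-single n k a 1≤k) ⟩
    ε ∙ (if k <ᵇ suc n then a else ε)   ≈⟨ identityˡ _ ⟩
    (if k <ᵇ suc n then a else ε)       ≡⟨ ≡.trans (if-< k<1+n) (≡.sym (if-< (ℕ.m<n⇒m<1+n k<1+n))) ⟩
    (if k <ᵇ suc (suc n) then a else ε) ∎
  ... | tri≈ _ refl _ = begin
    (if suc n ≡ᵇ suc n then a else ε) ∙ Π n (λ x → if x ≡ᵇ suc n then a else ε)
      ≈⟨ ∙-cong (reflexive (if-≡ᵇ-refl (suc n))) (Π-single n (suc n) a 1≤k) ⟩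
    a ∙ (if suc n <ᵇ suc n then a else ε) ≈⟨ ∙-congˡ (reflexive (if-≮ {m = suc n} (ℕ.<-irrefl refl))) ⟩
    a ∙ ε                                 ≈⟨ identityʳ a ⟩
    a                                     ≡⟨ ≡.sym (if-< (ℕ.n<1+n (suc n))) ⟩
    (if suc n <ᵇ suc (suc n) then a else ε) ∎
  ... | tri> _ _ 1+n<k = begin
    (if suc n ≡ᵇ k then a else ε) ∙ Π n (λ x → if x ≡ᵇ k then a else ε)
      ≈⟨ ∙-cong (reflexive (if-≢ (ℕ.<⇒≢ 1+n<k))) (Π-single n k a 1≤k) ⟩
    ε ∙ (if k <ᵇ suc n then a else ε)   ≈⟨ identityˡ _ ⟩
    (if k <ᵇ suc n then a else ε)       ≡⟨ ≡.trans (if-≮ (ℕ.<⇒≯ 1+n<k)) (≡.sym (if-≮ (ℕ.≤⇒≯ 1+n<k))) ⟩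
    (if k <ᵇ suc (suc n) then a else ε) ∎

  private
    erase : ℕ → (ℕ → C) → ℕ → C
    erase k f x = if x ≡ᵇ k then ε else f x

    Π-extract : ∀ n k (f : ℕ → C) → 1 ≤ k → k ≤ n → Π n f ≈ f k ∙ Π n (erase k f)
    Π-extract zero zero f () z≤n
    Π-extract (suc n) k f 1≤k k≤1+n with ℕ.m≤n⇒m<n∨m≡n k≤1+n
    ... | inj₂ refl = ∙-congˡ (begin
      Π n f                                           ≈⟨ Π-cong n (λ x _ x≤n → reflexive (≡.sym (if-≢ (ℕ.<⇒≢ (s≤s x≤n))))) ⟩
      Π n (erase (suc n) f)                           ≈⟨ ≈-sym (identityˡ _) ⟩
      ε ∙ Π n (erase (suc n) f)                       ≈⟨ ∙-congʳ (reflexive (≡.sym (if-≡ᵇ-refl (suc n)))) ⟩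
      erase (suc n) f (suc n) ∙ Π n (erase (suc n) f) ∎)
    ... | inj₁ (s≤s k≤n) = begin
      f (suc n) ∙ Π n f                           ≈⟨ ∙-congˡ (Π-extract n k f 1≤k k≤n) ⟩
      f (suc n) ∙ (f k ∙ Π n (erase k f))         ≈⟨ x∙yz≈y∙xz _ _ _ ⟩
      f k ∙ (f (suc n) ∙ Π n (erase k f))         ≈⟨ ∙-congˡ (∙-congʳ (reflexive (≡.sym (if-≢ (ℕ.>⇒≢ (s≤s k≤n)))))) ⟩
      f k ∙ (erase k f (suc n) ∙ Π n (erase k f)) ∎

  Π-involution : ∀ n {σ} → IsInvolutionOn n σ → (f : ℕ → C) → Π n (λ x → f (σ x)) ≈ Π n f
  Π-involution zero σ-inv f = ≈-refl
  Π-involution (suc n) {σ} σ-inv f with σ (suc n) ℕ.≟ suc n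
  ... | yes σs≡s = ∙-cong (reflexive (cong f σs≡s)) (Π-involution n (restrictInvolution σ-inv σs≡s) f)
  ... | no σs≢s = begin
    f k ∙ Π n (λ x → f (σ x))                             ≈⟨ ∙-congˡ (Π-extract n k (λ x → f (σ x)) 1≤k k≤n) ⟩
    f k ∙ (f (σ k) ∙ Π n (erase k (λ x → f (σ x))))       ≈⟨ ∙-congˡ (∙-congʳ (reflexive (cong f σk≡s))) ⟩
    f k ∙ (f (suc n) ∙ Π n (erase k (λ x → f (σ x))))     ≈⟨ x∙yz≈y∙xz _ _ _ ⟩
    f (suc n) ∙ (f k ∙ Π n (erase k (λ x → f (σ x))))     ≈⟨ ∙-congˡ (∙-cong (reflexive (cong f (≡.sym τk≡k))) (Π-cong n same-erasure)) ⟩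
    f (suc n) ∙ (f (τ k) ∙ Π n (erase k (λ x → f (τ x)))) ≈⟨ ∙-congˡ (≈-sym (Π-extract n k (λ x → f (τ x)) 1≤k k≤n)) ⟩
    f (suc n) ∙ Π n (λ x → f (τ x))                       ≈⟨ ∙-congˡ (Π-involution n (dropCycle-involution σ-inv σs≢s) f) ⟩
    f (suc n) ∙ Π n f                                     ∎
    where
    open IsInvolutionOn σ-inv
    k = σ (suc n)
    τ = dropCycle σ (suc n)
    1≤k : 1 ≤ k
    1≤k = proj₁ (closed (suc n) (s≤s z≤n) ℕ.≤-refl)
    k≤n : k ≤ n
    k≤n = ℕ.≤-pred (ℕ.≤∧≢⇒< (proj₂ (closed (suc n) (s≤s z≤n) ℕ.≤-refl)) σs≢s)
    σk≡s : σ k ≡ suc n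
    σk≡s = involutive (suc n) (s≤s z≤n) ℕ.≤-refl
    τk≡k : τ k ≡ k
    τk≡k = if-≡ᵇ-refl k
    same-erasure : ∀ x → 1 ≤ x → x ≤ n → erase k (λ x → f (σ x)) x ≈ erase k (λ x → f (τ x)) x
    same-erasure x _ _ with x ℕ.≟ k
    ... | yes refl = reflexive (≡.trans (if-≡ᵇ-refl k) (≡.sym (if-≡ᵇ-refl k)))
    ... | no x≢k = reflexive (≡.trans (if-≢ x≢k) (≡.trans (cong f (≡.sym (if-≢ x≢k))) (≡.sym (if-≢ x≢k))))

  Π-reverse : ∀ n (f : ℕ → C) → Π n (λ x → f (suc n ∸ x)) ≈ Π n f
  Π-reverse n = Π-involution n record
    { closed = λ x 1≤x x≤n → ℕ.m<n⇒0<n∸m (s≤s x≤n) , ℕ.m≤n+o⇒m∸n≤o (suc n) x (ℕ.+-monoˡ-≤ n 1≤x)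
    ; involutive = λ x _ x≤n → ℕ.m∸[m∸n]≡n (ℕ.m≤n⇒m≤1+n x≤n) }

  Π-indicator : ∀ n (b : ℕ → Bool) (a : C) → Π n (λ x → if b x then a else ε) ≈ Π (count n b) (λ _ → a)
  Π-indicator zero b a = ≈-refl
  Π-indicator (suc n) b a with b (suc n)
  ... | true = ∙-congˡ (Π-indicator n b a)
  ... | false = ≈-trans (identityˡ _) (Π-indicator n b a)

  pairUp : (ℕ → ℕ) → (ℕ → C) → ℕ → C
  pairUp σ f x = if x <ᵇ σ x then f x ∙ f (σ x) else if x ≡ᵇ σ x then f x else ε

  pairUp-< : ∀ σ f x → x < σ x → pairUp σ f x ≡ f x ∙ f (σ x)
  pairUp-< σ f x x<σx = if-< x<σx

  pairUp-≡ : ∀ σ f x → x ≡ σ x → pairUp σ f x ≡ f x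
  pairUp-≡ σ f x x≡σx = ≡.trans (if-≮ (ℕ.<-irrefl x≡σx)) (if-T (ℕ.≡⇒≡ᵇ x (σ x) x≡σx))

  pairUp-> : ∀ σ f x → σ x < x → pairUp σ f x ≡ ε
  pairUp-> σ f x σx<x = ≡.trans (if-≮ (ℕ.<⇒≯ σx<x)) (if-≢ (ℕ.>⇒≢ σx<x))

  Π-pairUp : ∀ n {σ} → IsInvolutionOn n σ → (f : ℕ → C) → Π n f ≈ Π n (pairUp σ f)
  Π-pairUp n {σ} σ-inv f = begin
    Π n f                                                     ≈⟨ Π-cong n (λ x _ _ → split x (σ x) (f x)) ⟩
    Π n (λ x → lower x (σ x) (f x) ∙ upper x)                 ≈⟨ Π-distrib n _ upper ⟩
    Π n (λ x → lower x (σ x) (f x)) ∙ Π n upper               ≈⟨ ∙-congˡ (≈-sym (Π-involution n σ-inv upper)) ⟩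
    Π n (λ x → lower x (σ x) (f x)) ∙ Π n (λ x → upper (σ x)) ≈⟨ ≈-sym (Π-distrib n _ _) ⟩
    Π n (λ x → lower x (σ x) (f x) ∙ upper (σ x))             ≈⟨ Π-cong n merge ⟩
    Π n (pairUp σ f)                                          ∎
    where
    open IsInvolutionOn σ-inv
    lower : ℕ → ℕ → C → C
    lower x y a = if x <ᵇ y then a else if x ≡ᵇ y then a else ε
    upper : ℕ → C
    upper x = if σ x <ᵇ x then f x else ε
    split : ∀ x y a → a ≈ lower x y a ∙ (if y <ᵇ x then a else ε)
    split x y a with ℕ.<-cmp x y
    ... | tri< x<y _ y≮x = ≈-sym (≈-trans (∙-cong (reflexive (if-< x<y)) (reflexive (if-≮ y≮x))) (identityʳ a))
    ... | tri≈ x≮y x≡y y≮x = ≈-sym (≈-trans (∙-cong (reflexive (≡.trans (if-≮ x≮y) (if-T (ℕ.≡⇒≡ᵇ x y x≡y)))) (reflexive (if-≮ y≮x))) (identityʳ a))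
    ... | tri> x≮y x≢y y<x = ≈-sym (≈-trans (∙-cong (reflexive (≡.trans (if-≮ x≮y) (if-≢ x≢y))) (reflexive (if-< y<x))) (identityˡ a))
    merge : ∀ x → 1 ≤ x → x ≤ n → lower x (σ x) (f x) ∙ upper (σ x) ≈ pairUp σ f x
    merge x 1≤x x≤n rewrite involutive x 1≤x x≤n with x <ᵇ σ x
    ... | true = ≈-refl
    ... | false = identityʳ _

double-injective : ∀ {m n} → m ℕ.+ m ≡ n ℕ.+ n → m ≡ n
double-injective {m} {n} m+m≡n+n with ℕ.<-cmp m n
... | tri< m<n _ _ = ⊥-elim (ℕ.<⇒≢ (ℕ.+-mono-< m<n m<n) m+m≡n+n)
... | tri≈ _ m≡n _ = m≡n
... | tri> _ _ n<m = ⊥-elim (ℕ.<⇒≢ (ℕ.+-mono-< n<m n<m) (≡.sym m+m≡n+n))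

module Counting where

  open import Data.Nat using (_+_)
  open RangeProduct ℕ.+-0-commutativeMonoid using (Π; Π-cong; Π-distrib; Π-involution)

  count≡Π : ∀ n b → count n b ≡ Π n (λ x → if b x then 1 else 0)
  count≡Π zero b = refl
  count≡Π (suc n) b with b (suc n)
  ... | true = cong suc (count≡Π n b)
  ... | false = count≡Π n b

  Π-one : ∀ n → Π n (λ _ → 1) ≡ n
  Π-one zero = refl
  Π-one (suc n) = cong suc (Π-one n)

  count-ascents : ∀ n {σ} → IsInvolutionOn n σ → (∀ x → 1 ≤ x → x ≤ n → x ≢ σ x) →
                  count n (λ x → x <ᵇ σ x) + count n (λ x → x <ᵇ σ x) ≡ n
  count-ascents n {σ} σ-inv no-fixed = begin
    count n ascent + count n ascent           ≡⟨ ≡.cong₂ _+_ (count≡Π n ascent) (count≡Π n ascent) ⟩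
    Π n (indicator ascent) + Π n (indicator ascent)
      ≡⟨ cong (λ z → Π n (indicator ascent) + z) (≡.trans (Π-cong n descent-after-σ) (Π-involution n σ-inv (indicator descent))) ⟩
    Π n (indicator ascent) + Π n (indicator descent) ≡⟨ ≡.sym (Π-distrib n _ _) ⟩
    Π n (λ x → indicator ascent x + indicator descent x) ≡⟨ Π-cong n (λ x 1≤x x≤n → one-of x (σ x) (no-fixed x 1≤x x≤n)) ⟩
    Π n (λ _ → 1)                              ≡⟨ Π-one n ⟩
    n                                          ∎
    where
    open ≡.≡-Reasoning
    open IsInvolutionOn σ-inv
    ascent descent : ℕ → Bool
    ascent x = x <ᵇ σ x
    descent x = σ x <ᵇ x
    indicator : (ℕ → Bool) → ℕ → ℕ
    indicator b x = if b x then 1 else 0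
    descent-after-σ : ∀ x → 1 ≤ x → x ≤ n → indicator ascent x ≡ indicator descent (σ x)
    descent-after-σ x 1≤x x≤n = cong (λ y → if y <ᵇ σ x then 1 else 0) (≡.sym (involutive x 1≤x x≤n))
    one-of : ∀ x y → x ≢ y → (if x <ᵇ y then 1 else 0) + (if y <ᵇ x then 1 else 0) ≡ 1
    one-of x y x≢y with ℕ.<-cmp x y
    ... | tri< x<y _ y≮x = ≡.cong₂ _+_ (if-< x<y) (if-≮ y≮x)
    ... | tri≈ _ x≡y _ = ⊥-elim (x≢y x≡y)
    ... | tri> x≮y _ y<x = ≡.cong₂ _+_ (if-≮ x≮y) (if-< y<x)

module ListProduct where

  open import Data.List using (List; []; _∷_; _++_; _∷ʳ_; map; filterᵇ; concatMap; [_])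
  open import Data.Nat.ListAction using (product)
  open import Data.Nat.ListAction.Properties using (product-++)
  import Data.List.Properties as List
  open RangeProduct ℕ.*-1-commutativeMonoid using (Π)

  product-filterᵇ : ∀ {A : Set} (b : A → Bool) (g : A → ℕ) xs →
    product (map g (filterᵇ b xs)) ≡ product (map (λ x → if b x then g x else 1) xs)
  product-filterᵇ b g [] = refl
  product-filterᵇ b g (x ∷ xs) with b x
  ... | true = cong (g x ℕ.*_) (product-filterᵇ b g xs)
  ... | false = ≡.trans (product-filterᵇ b g xs) (≡.sym (ℕ.*-identityˡ _))

  product-concatMap : ∀ {A B : Set} (g : B → ℕ) (f : A → List B) xs →
    product (map g (concatMap f xs)) ≡ product (map (λ x → product (map g (f x))) xs)
  product-concatMap g f [] = refl
  product-concatMap g f (x ∷ xs) =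
    ≡.trans (cong product (List.map-++ g (f x) (concatMap f xs)))
      (≡.trans (product-++ (map g (f x)) (map g (concatMap f xs)))
        (cong (product (map g (f x)) ℕ.*_) (product-concatMap g f xs)))

  product-map-map : ∀ {A B : Set} (g : B → ℕ) (f : A → B) xs →
    product (map g (map f xs)) ≡ product (map (λ x → g (f x)) xs)
  product-map-map g f xs = cong product (≡.sym (List.map-∘ xs))

  product-range1 : ∀ (g : ℕ → ℕ) n → product (map g (range1 n)) ≡ Π n g
  product-range1 g zero = refl
  product-range1 g (suc n) = begin
    product (map g (map suc (upTo (suc n))))         ≡⟨ cong (λ xs → product (map g (map suc xs))) (≡.sym (List.upTo-∷ʳ n)) ⟩
    product (map g (map suc (upTo n ∷ʳ n)))          ≡⟨ cong (λ xs → product (map g xs)) (List.map-++ suc (upTo n) [ n ]) ⟩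
    product (map g (range1 n ++ [ suc n ]))          ≡⟨ cong product (List.map-++ g (range1 n) [ suc n ]) ⟩
    product (map g (range1 n) ++ [ g (suc n) ])      ≡⟨ product-++ (map g (range1 n)) [ g (suc n) ] ⟩
    product (map g (range1 n)) ℕ.* (g (suc n) ℕ.* 1) ≡⟨ ≡.cong₂ ℕ._*_ (product-range1 g n) (ℕ.*-identityʳ (g (suc n))) ⟩
    Π n g ℕ.* g (suc n)                              ≡⟨ ℕ.*-comm (Π n g) (g (suc n)) ⟩
    Π (suc n) g                                      ∎
    where open ≡.≡-Reasoning

pos-∸ : ∀ {m n} → n ≤ m → + (m ∸ n) ≡ + m - + n
pos-∸ {m} {n} n≤m = ≡.trans (≡.sym (ℤ.⊖-≥ n≤m)) (≡.sym (ℤ.m-n≡m⊖n m n))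

^-square : ∀ a n → (a * a) ^ n ≡ a ^ (n ℕ.+ n)
^-square a zero = refl
^-square a (suc n) = begin
  a * a * (a * a) ^ n     ≡⟨ cong (a * a *_) (^-square a n) ⟩
  a * a * a ^ (n ℕ.+ n)   ≡⟨ ℤ.*-assoc a a _ ⟩
  a * (a * a ^ (n ℕ.+ n)) ≡⟨ cong (λ k → a ^ suc k) (≡.sym (ℕ.+-suc n n)) ⟩
  a * a ^ (n ℕ.+ suc n)   ∎
  where open ≡.≡-Reasoning

-1ℤ^[n+n]≡1 : ∀ n → -1ℤ ^ (n ℕ.+ n) ≡ + 1
-1ℤ^[n+n]≡1 n = ≡.trans (≡.sym (^-square -1ℤ n)) (ℤ.^-zeroˡ n)

-1ℤ^n*-1ℤ^n≡1 : ∀ n → -1ℤ ^ n * -1ℤ ^ n ≡ + 1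
-1ℤ^n*-1ℤ^n≡1 n = ≡.trans (≡.sym (ℤ.^-distribˡ-+-* -1ℤ n n)) (-1ℤ^[n+n]≡1 n)

-1ℤ^m≡-1ℤ^n*-1ℤ^[n∸m] : ∀ {m n} → m ≤ n → -1ℤ ^ m ≡ -1ℤ ^ n * -1ℤ ^ (n ∸ m)
-1ℤ^m≡-1ℤ^n*-1ℤ^[n∸m] {m} {n} m≤n = begin
  a           ≡⟨ ≡.sym (≡.trans (cong (a *_) (-1ℤ^n*-1ℤ^n≡1 (n ∸ m))) (ℤ.*-identityʳ a)) ⟩
  a * (b * b) ≡⟨ ≡.sym (ℤ.*-assoc a b b) ⟩
  a * b * b   ≡⟨ cong (_* b) (≡.trans (≡.sym (ℤ.^-distribˡ-+-* -1ℤ m (n ∸ m))) (cong (-1ℤ ^_) (ℕ.m+[n∸m]≡n m≤n))) ⟩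
  -1ℤ ^ n * b ∎
  where
  open ≡.≡-Reasoning
  a = -1ℤ ^ m
  b = -1ℤ ^ (n ∸ m)

signed : ℕ → ℤ
signed y = -1ℤ ^ y * + y

signed-difference-of-squares : ∀ {a b} → a ≤ b → + (b ℕ.* b ∸ a ℕ.* a) ≡ signed (b ∸ a) * signed (b ℕ.+ a)
signed-difference-of-squares {a} {b} a≤b = begin
  + (b ℕ.* b ∸ a ℕ.* a)                                       ≡⟨ pos-∸ (ℕ.*-mono-≤ a≤b a≤b) ⟩
  + (b ℕ.* b) - + (a ℕ.* a)                                   ≡⟨ ≡.cong₂ _-_ (ℤ.pos-* b b) (ℤ.pos-* a a) ⟩
  + b * + b - + a * + a                                       ≡⟨ factor (+ b) (+ a) ⟩
  (+ b - + a) * (+ b ℤ.+ + a)                                 ≡⟨ ≡.cong₂ _*_ (≡.sym (pos-∸ a≤b)) (≡.sym (ℤ.pos-+ b a)) ⟩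
  + (b ∸ a) * + (b ℕ.+ a)                                     ≡⟨ ≡.sym (ℤ.*-identityˡ _) ⟩
  + 1 * (+ (b ∸ a) * + (b ℕ.+ a))                             ≡⟨ cong (_* (+ (b ∸ a) * + (b ℕ.+ a))) (≡.sym signs) ⟩
  -1ℤ ^ (b ∸ a) * -1ℤ ^ (b ℕ.+ a) * (+ (b ∸ a) * + (b ℕ.+ a)) ≡⟨ interchange (-1ℤ ^ (b ∸ a)) _ _ _ ⟩
  signed (b ∸ a) * signed (b ℕ.+ a)                           ∎
  where
  open ≡.≡-Reasoning
  factor : ∀ b a → b * b - a * a ≡ (b - a) * (b ℤ.+ a)
  factor = solve-∀
  interchange : ∀ s t x y → s * t * (x * y) ≡ s * x * (t * y)
  interchange = solve-∀
  signs : -1ℤ ^ (b ∸ a) * -1ℤ ^ (b ℕ.+ a) ≡ + 1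
  signs = ≡.trans (≡.sym (ℤ.^-distribˡ-+-* -1ℤ (b ∸ a) (b ℕ.+ a)))
            (≡.trans (cong (-1ℤ ^_) (≡.trans (≡.sym (ℕ.+-assoc (b ∸ a) b a))
              (≡.trans (cong (ℕ._+ a) (ℕ.+-comm (b ∸ a) b)) (≡.trans (ℕ.+-assoc b (b ∸ a) a) (cong (b ℕ.+_) (ℕ.m∸n+n≡m a≤b))))))
              (-1ℤ^[n+n]≡1 b))

module Congruence (p : ℕ) where

  open import Data.Integer using (_+_)

  -- A record rather than a synonym, so that a and b can be inferred from a ≈ b.
  infix 4 _≈_
  record _≈_ (a b : ℤ) : Set where
    constructor fromDivides
    field divides : + p ℤ.∣ (a - b)
  open _≈_ public

  toMod : ∀ {a b} → a ≈ b → a ≡ b [mod p ]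
  toMod a≈b = ℤ.∣⇒∣ᵤ (divides a≈b)

  ≈-intro : ∀ {a b} q → a - b ≡ q * + p → a ≈ b
  ≈-intro q eq = fromDivides (ℤ.divides q eq)

  ≈-refl : ∀ {a} → a ≈ a
  ≈-refl {a} = ≈-intro (+ 0) (≡.trans (ℤ.+-inverseʳ a) (≡.sym (ℤ.*-zeroˡ (+ p))))

  ≈-reflexive : ∀ {a b} → a ≡ b → a ≈ b
  ≈-reflexive refl = ≈-refl

  ≈-sym : ∀ {a b} → a ≈ b → b ≈ a
  ≈-sym {a} {b} a≈b = fromDivides (≡.subst (+ p ℤ.∣_) (difference-swap a b) (ℤ.∣m⇒∣-m (divides a≈b)))
    where
    difference-swap : ∀ a b → - (a - b) ≡ b - a
    difference-swap = solve-∀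

  ≈-trans : ∀ {a b c} → a ≈ b → b ≈ c → a ≈ c
  ≈-trans {a} {b} {c} a≈b b≈c =
    fromDivides (≡.subst (+ p ℤ.∣_) (telescope a b c) (ℤ.∣m∣n⇒∣m+n (divides a≈b) (divides b≈c)))
    where
    telescope : ∀ a b c → (a - b) + (b - c) ≡ a - c
    telescope = solve-∀

  +-cong : ∀ {a b c d} → a ≈ b → c ≈ d → a + c ≈ b + d
  +-cong {a} {b} {c} {d} a≈b c≈d =
    fromDivides (≡.subst (+ p ℤ.∣_) (regroup a b c d) (ℤ.∣m∣n⇒∣m+n (divides a≈b) (divides c≈d)))
    where
    regroup : ∀ a b c d → (a - b) + (c - d) ≡ (a + c) - (b + d)
    regroup = solve-∀

  *-cong : ∀ {a b c d} → a ≈ b → c ≈ d → a * c ≈ b * d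
  *-cong {a} {b} {c} {d} a≈b c≈d =
    fromDivides (≡.subst (+ p ℤ.∣_) (regroup a b c d)
      (ℤ.∣m∣n⇒∣m+n (ℤ.∣n⇒∣m*n a (divides c≈d)) (ℤ.∣m⇒∣m*n d (divides a≈b))))
    where
    regroup : ∀ a b c d → a * (c - d) + (a - b) * d ≡ a * c - b * d
    regroup = solve-∀

  -‿cong : ∀ {a b} → a ≈ b → - a ≈ - b
  -‿cong {a} {b} a≈b = fromDivides (≡.subst (+ p ℤ.∣_) (negate a b) (ℤ.∣m⇒∣-m (divides a≈b)))
    where
    negate : ∀ a b → - (a - b) ≡ - a - - b
    negate = solve-∀

  *-congˡ : ∀ c {a b} → a ≈ b → c * a ≈ c * b
  *-congˡ c = *-cong (≈-refl {c})

  *-congʳ : ∀ c {a b} → a ≈ b → a * c ≈ b * c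
  *-congʳ c a≈b = *-cong a≈b (≈-refl {c})

  setoid : Setoid _ _
  setoid = record { Carrier = ℤ ; _≈_ = _≈_ ; isEquivalence = record { refl = ≈-refl ; sym = ≈-sym ; trans = ≈-trans } }

  *-commutativeMonoid : CommutativeMonoid _ _
  *-commutativeMonoid = record
    { Carrier = ℤ ; _≈_ = _≈_ ; _∙_ = _*_ ; ε = + 1
    ; isCommutativeMonoid = record
      { isMonoid = record
        { isSemigroup = record
          { isMagma = record { isEquivalence = Setoid.isEquivalence setoid ; ∙-cong = *-cong }
          ; assoc = λ a b c → ≈-reflexive (ℤ.*-assoc a b c) }
        ; identity = (λ a → ≈-reflexive (ℤ.*-identityˡ a)) , (λ a → ≈-reflexive (ℤ.*-identityʳ a)) }
      ; comm = λ a b → ≈-reflexive (ℤ.*-comm a b) } }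

  p≈0 : + p ≈ + 0
  p≈0 = ≈-intro (+ 1) (≡.trans (ℤ.+-identityʳ (+ p)) (≡.sym (ℤ.*-identityˡ (+ p))))

  ≈⇒-≈0 : ∀ {a b} → a ≈ b → a - b ≈ + 0
  ≈⇒-≈0 {a} {b} a≈b = ≈-trans (+-cong a≈b (≈-refl { - b})) (≈-reflexive (ℤ.+-inverseʳ b))

  -≈0⇒≈ : ∀ {a b} → a - b ≈ + 0 → a ≈ b
  -≈0⇒≈ {a} {b} a-b≈0 = ≈-trans (≈-reflexive (add-back a b)) (≈-trans (+-cong a-b≈0 (≈-refl {b})) (≈-reflexive (ℤ.+-identityˡ b)))
    where
    add-back : ∀ a b → a ≡ (a - b) + b
    add-back = solve-∀

  %ℕ-≈ : ∀ a .{{_ : NonZero p}} → + (a ℤ.%ℕ p) ≈ a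
  %ℕ-≈ a = ≈-sym (≈-intro (a ℤ./ℕ p) (begin
    a - + (a ℤ.%ℕ p)                               ≡⟨ cong (_- + (a ℤ.%ℕ p)) (ℤ.a≡a%ℕn+[a/ℕn]*n a p) ⟩
    + (a ℤ.%ℕ p) + (a ℤ./ℕ p) * + p - + (a ℤ.%ℕ p) ≡⟨ cancel (+ (a ℤ.%ℕ p)) ((a ℤ./ℕ p) * + p) ⟩
    (a ℤ./ℕ p) * + p                               ∎))
    where
    open ≡.≡-Reasoning
    cancel : ∀ r q → r + q - r ≡ q
    cancel = solve-∀

  %-≈ : ∀ x .{{_ : NonZero p}} → + (x % p) ≈ + x
  %-≈ x = %ℕ-≈ (+ x)

  ^-cong : ∀ n {a b} → a ≈ b → a ^ n ≈ b ^ n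
  ^-cong zero a≈b = ≈-refl
  ^-cong (suc n) a≈b = *-cong a≈b (^-cong n a≈b)

  ∣∣⇒≈0 : ∀ {a} → p ℕ.∣ ℤ.∣ a ∣ → a ≈ + 0
  ∣∣⇒≈0 {a} p∣a = fromDivides (ℤ.∣ᵤ⇒∣ (≡.subst (p ℕ.∣_) (cong ℤ.∣_∣ (≡.sym (ℤ.+-identityʳ a))) p∣a))

  ≈0⇒∣∣ : ∀ {a} → a ≈ + 0 → p ℕ.∣ ℤ.∣ a ∣
  ≈0⇒∣∣ {a} a≈0 = ≡.subst (p ℕ.∣_) (cong ℤ.∣_∣ (ℤ.+-identityʳ a)) (ℤ.∣⇒∣ᵤ (divides a≈0))

  infix 4 _≉_ _≈±_
  _≉_ : ℤ → ℤ → Set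
  a ≉ b = ¬ a ≈ b

  _≈±_ : ℤ → ℤ → Set
  a ≈± b = a ≈ b ⊎ a ≈ - b

  ≈±-sym : ∀ {a b} → a ≈± b → b ≈± a
  ≈±-sym (inj₁ a≈b) = inj₁ (≈-sym a≈b)
  ≈±-sym {a} {b} (inj₂ a≈-b) = inj₂ (≈-trans (≈-reflexive (≡.sym (ℤ.neg-involutive b))) (-‿cong (≈-sym a≈-b)))

  ≈±-trans : ∀ {a b c} → a ≈± b → b ≈± c → a ≈± c
  ≈±-trans (inj₁ a≈b) (inj₁ b≈c) = inj₁ (≈-trans a≈b b≈c)
  ≈±-trans (inj₁ a≈b) (inj₂ b≈-c) = inj₂ (≈-trans a≈b b≈-c)
  ≈±-trans (inj₂ a≈-b) (inj₁ b≈c) = inj₂ (≈-trans a≈-b (-‿cong b≈c))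
  ≈±-trans {c = c} (inj₂ a≈-b) (inj₂ b≈-c) = inj₁ (≈-trans a≈-b (≈-trans (-‿cong b≈-c) (≈-reflexive (ℤ.neg-involutive c))))

  ≈⇒≈± : ∀ {a b} → a ≈ b → a ≈± b
  ≈⇒≈± = inj₁

  ≈±-*-congˡ : ∀ c {a b} → a ≈± b → c * a ≈± c * b
  ≈±-*-congˡ c (inj₁ a≈b) = inj₁ (*-congˡ c a≈b)
  ≈±-*-congˡ c {a} {b} (inj₂ a≈-b) = inj₂ (≈-trans (*-congˡ c a≈-b) (≈-reflexive (≡.sym (ℤ.neg-distribʳ-* c b))))

  ≈±⇒square≈ : ∀ {a b} → a ≈± b → a * a ≈ b * b
  ≈±⇒square≈ (inj₁ a≈b) = *-cong a≈b a≈b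
  ≈±⇒square≈ {a} {b} (inj₂ a≈-b) = ≈-trans (*-cong a≈-b a≈-b) (≈-reflexive (neg-square b))
    where
    neg-square : ∀ b → - b * - b ≡ b * b
    neg-square = solve-∀

module PrimeModulus (p : ℕ) (p-prime : Prime p) where

  open import Data.Integer using (_+_)
  open Congruence p public
  open import Relation.Binary.Reasoning.Setoid setoid

  instance
    p-nonZero : NonZero p
    p-nonZero = Prime.prime⇒nonZero p-prime

  residue≈0 : ∀ {x} → x < p → + x ≈ + 0 → x ≡ 0
  residue≈0 {zero} _ _ = refl
  residue≈0 {suc x} x<p x≈0 = ⊥-elim (ℕ.<⇒≱ x<p (ℕ.∣⇒≤ (≈0⇒∣∣ x≈0)))

  nonzero-residue : ∀ {x} → 1 ≤ x → x < p → + x ≉ + 0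
  nonzero-residue {suc x} _ x<p x≈0 with residue≈0 x<p x≈0
  ... | ()

  residue-injective : ∀ {x y} → x < p → y < p → + x ≈ + y → x ≡ y
  residue-injective {x} {y} x<p y<p x≈y with ℕ.<-cmp x y
  ... | tri< x<y _ _ = ⊥-elim (nonzero-residue (ℕ.m<n⇒0<n∸m x<y) (ℕ.≤-<-trans (ℕ.m∸n≤m y x) y<p)
        (≡.subst (_≈ + 0) (≡.sym (pos-∸ (ℕ.<⇒≤ x<y))) (≈⇒-≈0 (≈-sym x≈y))))
  ... | tri≈ _ x≡y _ = x≡y
  ... | tri> _ _ y<x = ⊥-elim (nonzero-residue (ℕ.m<n⇒0<n∸m y<x) (ℕ.≤-<-trans (ℕ.m∸n≤m x y) x<p)
        (≡.subst (_≈ + 0) (≡.sym (pos-∸ (ℕ.<⇒≤ y<x))) (≈⇒-≈0 x≈y)))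

  zero-product : ∀ a b → a * b ≈ + 0 → a ≈ + 0 ⊎ b ≈ + 0
  zero-product a b ab≈0 with Prime.euclidsLemma ℤ.∣ a ∣ ℤ.∣ b ∣ p-prime (≡.subst (p ℕ.∣_) (ℤ.abs-* a b) (≈0⇒∣∣ ab≈0))
  ... | inj₁ p∣a = inj₁ (∣∣⇒≈0 p∣a)
  ... | inj₂ p∣b = inj₂ (∣∣⇒≈0 p∣b)

  *-≉0 : ∀ {a b} → a ≉ + 0 → b ≉ + 0 → a * b ≉ + 0
  *-≉0 {a} {b} a≉0 b≉0 ab≈0 with zero-product a b ab≈0
  ... | inj₁ a≈0 = a≉0 a≈0
  ... | inj₂ b≈0 = b≉0 b≈0

  *-cancelˡ : ∀ {c a b} → c ≉ + 0 → c * a ≈ c * b → a ≈ b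
  *-cancelˡ {c} {a} {b} c≉0 ca≈cb =
    [ (λ c≈0 → ⊥-elim (c≉0 c≈0)) , -≈0⇒≈ ]′ (zero-product c (a - b) (≈-trans (≈-reflexive (factor c a b)) (≈⇒-≈0 ca≈cb)))
    where
    factor : ∀ c a b → c * (a - b) ≡ c * a - c * b
    factor = solve-∀

  *-cancelˡ-≈± : ∀ {c a b} → c ≉ + 0 → c * a ≈± c * b → a ≈± b
  *-cancelˡ-≈± c≉0 (inj₁ ca≈cb) = inj₁ (*-cancelˡ c≉0 ca≈cb)
  *-cancelˡ-≈± {c} {a} {b} c≉0 (inj₂ ca≈-cb) = inj₂ (*-cancelˡ c≉0 (≈-trans ca≈-cb (≈-reflexive (ℤ.neg-distribʳ-* c b))))

  square-root : ∀ a b → a * a ≈ b * b → a ≈± b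
  square-root a b a²≈b² =
    Sum.map -≈0⇒≈ (λ a+b≈0 → -≈0⇒≈ (≈-trans (≈-reflexive (cong (λ y → a + y) (ℤ.neg-involutive b))) a+b≈0))
      (zero-product (a - b) (a + b) (≈-trans (≈-reflexive (difference-of-squares a b)) (≈⇒-≈0 a²≈b²)))
    where
    difference-of-squares : ∀ a b → (a - b) * (a + b) ≡ a * a - b * b
    difference-of-squares = solve-∀

  %≡0⇒≈0 : ∀ x → x % p ≡ 0 → + x ≈ + 0
  %≡0⇒≈0 x x%p≡0 = ≈-trans (≈-sym (%-≈ x)) (≈-reflexive (cong +_ x%p≡0))

  ≈0⇒%≡0 : ∀ x → + x ≈ + 0 → x % p ≡ 0
  ≈0⇒%≡0 x x≈0 = residue≈0 (DivMod.m%n<n x p) (≈-trans (%-≈ x) x≈0)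

  1≉0 : + 1 ≉ + 0
  1≉0 = nonzero-residue ℕ.≤-refl (ℕ.nonTrivial⇒n>1 p {{Prime.prime⇒nonTrivial p-prime}})

  private
    gcd≡1 : ∀ {x d} → + x ≉ + 0 → GCD x p d → d ≡ 1
    gcd≡1 x≉0 g with Prime.prime⇒irreducible p-prime (GCD.gcd∣n g)
    ... | inj₁ d≡1 = d≡1
    ... | inj₂ refl = ⊥-elim (x≉0 (∣∣⇒≈0 (GCD.gcd∣m g)))

  inverse : ℕ → ℤ
  inverse x with Bézout.lemma x p
  ... | Bézout.result _ _ (Bézout.+- a _ _) = + a
  ... | Bézout.result _ _ (Bézout.-+ a _ _) = - + a

  *-inverse : ∀ x → + x ≉ + 0 → + x * inverse x ≈ + 1
  *-inverse x x≉0 with Bézout.lemma x p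
  ... | Bézout.result d g (Bézout.+- a b eq) with gcd≡1 x≉0 g
  ...   | refl = begin
    + x * + a         ≡⟨ ℤ.*-comm (+ x) (+ a) ⟩
    + a * + x         ≡⟨ ≡.sym (ℤ.pos-* a x) ⟩
    + (a ℕ.* x)       ≡⟨ cong +_ (≡.sym eq) ⟩
    + (1 ℕ.+ b ℕ.* p) ≡⟨ ≡.trans (ℤ.pos-+ 1 (b ℕ.* p)) (cong (λ y → + 1 + y) (ℤ.pos-* b p)) ⟩
    + 1 + + b * + p   ≈⟨ +-cong (≈-refl {+ 1}) (*-congˡ (+ b) p≈0) ⟩
    + 1 + + b * + 0   ≡⟨ cong (λ y → + 1 + y) (ℤ.*-zeroʳ (+ b)) ⟩
    + 1               ∎
  *-inverse x x≉0 | Bézout.result d g (Bézout.-+ a b eq) with gcd≡1 x≉0 g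
  ...   | refl = begin
    + x * - + a             ≡⟨ neg-swap (+ x) (+ a) ⟩
    + 1 - (+ 1 + + a * + x) ≡⟨ cong (λ y → + 1 - y) (≡.trans (cong (λ y → + 1 + y) (≡.sym (ℤ.pos-* a x))) (≡.trans (≡.sym (ℤ.pos-+ 1 (a ℕ.* x))) (cong +_ eq))) ⟩
    + 1 - + (b ℕ.* p)       ≡⟨ cong (λ y → + 1 - y) (ℤ.pos-* b p) ⟩
    + 1 - + b * + p         ≈⟨ +-cong (≈-refl {+ 1}) (-‿cong (*-congˡ (+ b) p≈0)) ⟩
    + 1 - + b * + 0         ≡⟨ cong (λ y → + 1 - y) (ℤ.*-zeroʳ (+ b)) ⟩
    + 1                     ∎
    where
    neg-swap : ∀ x a → x * - a ≡ + 1 - (+ 1 + a * x)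
    neg-swap = solve-∀


module OddPrime (h : ℕ) (p-prime : Prime (suc (h ℕ.+ h))) where

  open import Data.Nat using (_+_)

  p : ℕ
  p = suc (h + h)

  open PrimeModulus p p-prime public
  open RangeProduct *-commutativeMonoid public
  open import Relation.Binary.Reasoning.Setoid setoid

  ≤h⇒<p : ∀ {x} → x ≤ h → x < p
  ≤h⇒<p x≤h = s≤s (ℕ.≤-trans x≤h (ℕ.m≤m+n h h))

  ≤p-1⇒<p : ∀ {x} → x ≤ h + h → x < p
  ≤p-1⇒<p = s≤s

  private
    double : ∀ r → 2 ℕ.* r ≡ r + r
    double r = cong (λ z → r + z) (ℕ.+-identityʳ r)

    large-residue : ∀ {r} → p < 2 ℕ.* r → h < r
    large-residue {r} p<2r = ℕ.≰⇒> λ r≤h →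
      ℕ.<-asym p<2r (≡.subst (_< p) (≡.sym (double r)) (s≤s (ℕ.+-mono-≤ r≤h r≤h)))

    small-residue : ∀ {r} → ¬ p < 2 ℕ.* r → r ≤ h
    small-residue {r} p≮2r = ℕ.≮⇒≥ λ h<r →
      p≮2r (≡.subst (p <_) (≡.sym (double r)) (≡.subst (_≤ r + r) (cong suc (ℕ.+-suc h h)) (ℕ.+-mono-≤ h<r h<r)))

  tilde-≤ : ∀ y → tilde p y ≤ h
  tilde-≤ y with p ℕ.<? 2 ℕ.* (y % p)
  ... | yes p<2r rewrite if-< {x = p ∸ y % p} {y % p} p<2r =
    ≡.subst (p ∸ y % p ≤_) (ℕ.m+n∸m≡n h h) (ℕ.∸-monoʳ-≤ p (large-residue {y % p} p<2r))
  ... | no p≮2r rewrite if-≮ {x = p ∸ y % p} {y % p} p≮2r = small-residue p≮2r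

  tilde-≈± : ∀ y → + tilde p y ≈± + y
  tilde-≈± y with p ℕ.<? 2 ℕ.* (y % p)
  ... | yes p<2r rewrite if-< {x = p ∸ y % p} {y % p} p<2r = inj₂ (begin
    + (p ∸ y % p)   ≡⟨ pos-∸ (ℕ.<⇒≤ (DivMod.m%n<n y p)) ⟩
    + p - + (y % p) ≈⟨ +-cong p≈0 (-‿cong (%-≈ y)) ⟩
    + 0 - + y       ≡⟨ ℤ.+-identityˡ (- + y) ⟩
    - + y           ∎)
  ... | no p≮2r rewrite if-≮ {x = p ∸ y % p} {y % p} p≮2r = inj₁ (%-≈ y)

  ≈±-injective : ∀ {a b} → a ≤ h → b ≤ h → + a ≈± + b → a ≡ b
  ≈±-injective a≤h b≤h (inj₁ a≈b) = residue-injective (≤h⇒<p a≤h) (≤h⇒<p b≤h) a≈b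
  ≈±-injective {a} {b} a≤h b≤h (inj₂ a≈-b) = ≡.trans (ℕ.m+n≡0⇒m≡0 a a+b≡0) (≡.sym (ℕ.m+n≡0⇒n≡0 a a+b≡0))
    where
    a+b≡0 : a + b ≡ 0
    a+b≡0 = residue≈0 (s≤s (ℕ.+-mono-≤ a≤h b≤h)) (begin
      + (a + b)     ≡⟨ ℤ.pos-+ a b ⟩
      + a ℤ.+ + b   ≈⟨ +-cong a≈-b (≈-refl {+ b}) ⟩
      - + b ℤ.+ + b ≡⟨ ℤ.+-inverseˡ (+ b) ⟩
      + 0           ∎)

  tilde-unique : ∀ {x} y → x ≤ h → + y ≈± + x → tilde p y ≡ x
  tilde-unique y x≤h y≈±x = ≈±-injective (tilde-≤ y) x≤h (≈±-trans (tilde-≈± y) y≈±x)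

  tilde-cong : ∀ y z → + y ≈± + z → tilde p y ≡ tilde p z
  tilde-cong y z y≈±z = tilde-unique y (tilde-≤ z) (≈±-trans y≈±z (≈±-sym (tilde-≈± z)))

  tilde-positive : ∀ y → + y ≉ + 0 → 1 ≤ tilde p y
  tilde-positive y y≉0 with tilde p y | tilde-≈± y
  ... | suc _ | _ = s≤s z≤n
  ... | zero | inj₁ 0≈y = ⊥-elim (y≉0 (≈-sym 0≈y))
  ... | zero | inj₂ 0≈-y = ⊥-elim (y≉0 (≈-trans (≈-reflexive (≡.sym (ℤ.neg-involutive (+ y)))) (≈-sym (-‿cong 0≈-y))))

  1≤h : 1 ≤ h
  1≤h = ℕ.n≢0⇒n>0 λ h≡0 → Prime.¬prime[1] (≡.subst (λ k → Prime (suc (k + k))) h≡0 p-prime)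

  2≉0 : + 2 ≉ + 0
  2≉0 = nonzero-residue (s≤s z≤n) (s≤s (ℕ.+-mono-≤ 1≤h 1≤h))

  factorial : ℕ → ℤ
  factorial n = Π n (λ x → + x)

  Π-const : ∀ n a → Π n (λ _ → a) ≡ a ^ n
  Π-const zero a = refl
  Π-const (suc n) a = cong (a *_) (Π-const n a)

  ≉0⇒positive : ∀ {x} → + x ≉ + 0 → 1 ≤ x
  ≉0⇒positive {zero} 0≉0 = ⊥-elim (0≉0 ≈-refl)
  ≉0⇒positive {suc x} _ = s≤s z≤n

  unit : ∀ {x} → 1 ≤ x → x ≤ h + h → + x ≉ + 0
  unit 1≤x x≤2h = nonzero-residue 1≤x (≤p-1⇒<p x≤2h)

  half-unit : ∀ {x} → 1 ≤ x → x ≤ h → + x ≉ + 0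
  half-unit 1≤x x≤h = nonzero-residue 1≤x (≤h⇒<p x≤h)

  -1≉0 : -1ℤ ≉ + 0
  -1≉0 -1≈0 = 1≉0 (-‿cong -1≈0)

  1≉-1 : + 1 ≉ -1ℤ
  1≉-1 1≈-1 = 2≉0 (≈⇒-≈0 1≈-1)

  p-1≈-1 : + (h + h) ≈ -1ℤ
  p-1≈-1 = ≈-intro (+ 1) (≡.trans (≡.sym (ℤ.pos-+ (h + h) 1)) (≡.trans (cong +_ (ℕ.+-comm (h + h) 1)) (≡.sym (ℤ.*-identityˡ (+ p)))))

  reciprocal : ℕ → ℕ → ℕ
  reciprocal c x = (+ c * inverse x) ℤ.%ℕ p

  reciprocal-< : ∀ c x → reciprocal c x < p
  reciprocal-< c x = ℤ.n%ℕd<d (+ c * inverse x) p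

  *-reciprocal : ∀ c x → + x ≉ + 0 → + x * + reciprocal c x ≈ + c
  *-reciprocal c x x≉0 = begin
    + x * + reciprocal c x  ≈⟨ *-congˡ (+ x) (%ℕ-≈ (+ c * inverse x)) ⟩
    + x * (+ c * inverse x) ≡⟨ ℤ.*-comm (+ x) _ ⟩
    + c * inverse x * + x   ≡⟨ ℤ.*-assoc (+ c) (inverse x) (+ x) ⟩
    + c * (inverse x * + x) ≡⟨ cong (+ c *_) (ℤ.*-comm (inverse x) (+ x)) ⟩
    + c * (+ x * inverse x) ≈⟨ *-congˡ (+ c) (*-inverse x x≉0) ⟩
    + c * + 1               ≡⟨ ℤ.*-identityʳ (+ c) ⟩
    + c                     ∎

  reciprocal-unique : ∀ c x {y} → + x ≉ + 0 → y < p → + x * + y ≈ + c → reciprocal c x ≡ y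
  reciprocal-unique c x x≉0 y<p xy≈c =
    residue-injective (reciprocal-< c x) y<p (*-cancelˡ x≉0 (≈-trans (*-reciprocal c x x≉0) (≈-sym xy≈c)))

  reciprocal-≉0 : ∀ c x → + c ≉ + 0 → + x ≉ + 0 → + reciprocal c x ≉ + 0
  reciprocal-≉0 c x c≉0 x≉0 r≈0 =
    c≉0 (≈-trans (≈-sym (*-reciprocal c x x≉0)) (≈-trans (*-congˡ (+ x) r≈0) (≈-reflexive (ℤ.*-zeroʳ (+ x)))))

  reciprocal-involution : ∀ c → + c ≉ + 0 → IsInvolutionOn (h + h) (reciprocal c)
  reciprocal-involution c c≉0 = record
    { closed = λ x 1≤x x≤2h → ≉0⇒positive (reciprocal-≉0 c x c≉0 (unit 1≤x x≤2h)) , ℕ.≤-pred (reciprocal-< c x)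
    ; involutive = λ x 1≤x x≤2h → reciprocal-unique c (reciprocal c x) (reciprocal-≉0 c x c≉0 (unit 1≤x x≤2h)) (≤p-1⇒<p x≤2h)
        (≈-trans (≈-reflexive (ℤ.*-comm _ (+ x))) (*-reciprocal c x (unit 1≤x x≤2h))) }

  reciprocal-reciprocal : ∀ c x → 1 ≤ x → x ≤ h + h → + reciprocal c (reciprocal 1 x) ≈ + c * + x
  reciprocal-reciprocal c x 1≤x x≤2h = *-cancelˡ u≉0 (begin
    + u * + reciprocal c u ≈⟨ *-reciprocal c u u≉0 ⟩
    + c                    ≈⟨ ≈-sym (≈-trans (*-congˡ (+ c) (*-reciprocal 1 x x≉0)) (≈-reflexive (ℤ.*-identityʳ (+ c)))) ⟩
    + c * (+ x * + u)      ≡⟨ rotate (+ c) (+ x) (+ u) ⟩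
    + u * (+ c * + x)      ∎)
    where
    u = reciprocal 1 x
    x≉0 = unit 1≤x x≤2h
    u≉0 = reciprocal-≉0 1 x 1≉0 x≉0
    rotate : ∀ c x u → c * (x * u) ≡ u * (c * x)
    rotate = solve-∀

  private
    square≈1 : ∀ {x} → x < p → + x * + x ≈ + 1 → x ≡ 1 ⊎ x ≡ h + h
    square≈1 {x} x<p x²≈1 with square-root (+ x) (+ 1) x²≈1
    ... | inj₁ x≈1 = inj₁ (residue-injective x<p (≤h⇒<p 1≤h) x≈1)
    ... | inj₂ x≈-1 = inj₂ (residue-injective x<p (≤p-1⇒<p ℕ.≤-refl) (≈-trans x≈-1 (≈-sym p-1≈-1)))

    reciprocal-p-1 : reciprocal 1 (h + h) ≡ h + h
    reciprocal-p-1 = reciprocal-unique 1 (h + h) (unit (ℕ.≤-trans 1≤h (ℕ.m≤m+n h h)) ℕ.≤-refl) (≤p-1⇒<p ℕ.≤-refl)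
      (≈-trans (*-cong p-1≈-1 p-1≈-1) ≈-refl)

    fixed-point-value : ∀ {x} → x < p → + x * + x ≈ + 1 → + x ≈ (if x ≡ᵇ h + h then -1ℤ else + 1)
    fixed-point-value {x} x<p x²≈1 with square≈1 x<p x²≈1
    ... | inj₁ x≡1 = ≈-reflexive (≡.trans (cong +_ x≡1) (≡.sym (if-≢ λ x≡2h → ℕ.<⇒≢ (ℕ.+-mono-≤ 1≤h 1≤h) (≡.trans (≡.sym x≡1) x≡2h))))
    ... | inj₂ x≡2h = ≈-trans (≈-reflexive (cong +_ x≡2h)) (≈-trans p-1≈-1 (≈-reflexive (≡.sym (if-T (ℕ.≡⇒≡ᵇ x (h + h) x≡2h)))))

  wilson : factorial (h + h) ≈ -1ℤ
  wilson = begin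
    factorial (h + h)                                 ≈⟨ Π-pairUp (h + h) σ-inv (λ x → + x) ⟩
    Π (h + h) (pairUp σ (λ x → + x))                  ≈⟨ Π-cong (h + h) pair-product ⟩
    Π (h + h) (λ x → if x ≡ᵇ h + h then -1ℤ else + 1) ≈⟨ Π-single (h + h) (h + h) -1ℤ 1≤2h ⟩
    (if h + h <ᵇ suc (h + h) then -1ℤ else + 1)       ≡⟨ if-< (ℕ.n<1+n (h + h)) ⟩
    -1ℤ                                               ∎
    where
    σ = reciprocal 1
    σ-inv = reciprocal-involution 1 1≉0
    1≤2h = ℕ.≤-trans 1≤h (ℕ.m≤m+n h h)
    pair-product : ∀ x → 1 ≤ x → x ≤ h + h → pairUp σ (λ x → + x) x ≈ (if x ≡ᵇ h + h then -1ℤ else + 1)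
    pair-product x 1≤x x≤2h with ℕ.<-cmp x (σ x)
    ... | tri< x<σx _ _ = ≈-trans (≈-reflexive (pairUp-< σ (λ x → + x) x x<σx)) (≈-trans (*-reciprocal 1 x (unit 1≤x x≤2h))
          (≈-reflexive (≡.sym (if-≢ (ℕ.<⇒≢ (ℕ.<-≤-trans x<σx (proj₂ (IsInvolutionOn.closed σ-inv x 1≤x x≤2h))))))))
    ... | tri≈ _ x≡σx _ = ≈-trans (≈-reflexive (pairUp-≡ σ (λ x → + x) x x≡σx)) (fixed-point-value (≤p-1⇒<p x≤2h)
          (≈-trans (*-congˡ (+ x) (≈-reflexive (cong +_ x≡σx))) (*-reciprocal 1 x (unit 1≤x x≤2h))))
    ... | tri> _ x≢σx σx<x = ≈-trans (≈-reflexive (pairUp-> σ (λ x → + x) x σx<x))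
          (≈-reflexive (≡.sym (if-≢ {m = x} {n = h + h} λ { refl → x≢σx (≡.sym reciprocal-p-1) })))

  factorial≉0 : factorial (h + h) ≉ + 0
  factorial≉0 fact≈0 = -1≉0 (≈-trans (≈-sym wilson) fact≈0)

  fermat : ∀ y → + y ≉ + 0 → (+ y) ^ (h + h) ≈ + 1
  fermat y y≉0 = *-cancelˡ factorial≉0 (begin
    factorial (h + h) * (+ y) ^ (h + h)               ≡⟨ ℤ.*-comm (factorial (h + h)) _ ⟩
    (+ y) ^ (h + h) * factorial (h + h)               ≡⟨ cong (_* factorial (h + h)) (≡.sym (Π-const (h + h) (+ y))) ⟩
    Π (h + h) (λ _ → + y) * factorial (h + h)         ≈⟨ ≈-sym (Π-distrib (h + h) _ _) ⟩
    Π (h + h) (λ x → + y * + x)                       ≈⟨ ≈-sym (Π-cong (h + h) (reciprocal-reciprocal y)) ⟩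
    Π (h + h) (λ x → + reciprocal y (reciprocal 1 x)) ≈⟨ Π-involution (h + h) (reciprocal-involution 1 1≉0) _ ⟩
    Π (h + h) (λ x → + reciprocal y x)                ≈⟨ Π-involution (h + h) (reciprocal-involution y y≉0) _ ⟩
    factorial (h + h)                                 ≡⟨ ≡.sym (ℤ.*-identityʳ _) ⟩
    factorial (h + h) * + 1                           ∎)

  euler-residue : ∀ x → + x ≉ + 0 → (+ x * + x) ^ h ≈ + 1
  euler-residue x x≉0 = ≈-trans (≈-reflexive (^-square (+ x) h)) (fermat x x≉0)

  euler-nonresidue : ∀ c → + c ≉ + 0 → (∀ x → + x * + x ≉ + c) → (+ c) ^ h ≈ -1ℤ
  euler-nonresidue c c≉0 nonresidue = begin
    (+ c) ^ h                                       ≡⟨ cong (λ k → (+ c) ^ k) (≡.sym ascents≡h) ⟩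
    (+ c) ^ count (h + h) ascent                    ≡⟨ ≡.sym (Π-const (count (h + h) ascent) (+ c)) ⟩
    Π (count (h + h) ascent) (λ _ → + c)            ≈⟨ ≈-sym (Π-indicator (h + h) ascent (+ c)) ⟩
    Π (h + h) (λ x → if ascent x then + c else + 1) ≈⟨ ≈-sym (Π-cong (h + h) pair-product) ⟩
    Π (h + h) (pairUp σ (λ x → + x))                ≈⟨ ≈-sym (Π-pairUp (h + h) σ-inv _) ⟩
    factorial (h + h)                               ≈⟨ wilson ⟩
    -1ℤ                                             ∎
    where
    σ = reciprocal c
    σ-inv = reciprocal-involution c c≉0
    ascent : ℕ → Bool
    ascent x = x <ᵇ σ x
    no-fixed-point : ∀ x → 1 ≤ x → x ≤ h + h → x ≢ σ x
    no-fixed-point x 1≤x x≤2h x≡σx =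
      nonresidue x (≈-trans (*-congˡ (+ x) (≈-reflexive (cong +_ x≡σx))) (*-reciprocal c x (unit 1≤x x≤2h)))
    ascents≡h : count (h + h) ascent ≡ h
    ascents≡h = double-injective (Counting.count-ascents (h + h) σ-inv no-fixed-point)
    pair-product : ∀ x → 1 ≤ x → x ≤ h + h → pairUp σ (λ x → + x) x ≈ (if ascent x then + c else + 1)
    pair-product x 1≤x x≤2h with ℕ.<-cmp x (σ x)
    ... | tri< x<σx _ _ = ≈-trans (≈-reflexive (pairUp-< σ (λ x → + x) x x<σx))
          (≈-trans (*-reciprocal c x (unit 1≤x x≤2h)) (≈-reflexive (≡.sym (if-< x<σx))))
    ... | tri≈ _ x≡σx _ = ⊥-elim (no-fixed-point x 1≤x x≤2h x≡σx)
    ... | tri> x≮σx _ σx<x = ≈-reflexive (≡.trans (pairUp-> σ (λ x → + x) x σx<x) (≡.sym (if-≮ x≮σx)))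

  legendre≈power : ∀ c → + c ≉ + 0 → legendre c p ≈ (+ c) ^ h
  legendre≈power c c≉0 = ≈-trans (≈-reflexive (if-≢ c%p≢0)) (by-cases (T? (any hits (upTo p))))
    where
    hits : ℕ → Bool
    hits x = ((x ℕ.* x) % p) ≡ᵇ (c % p)
    c%p≢0 : c % p ≢ 0
    c%p≢0 c%p≡0 = c≉0 (≈-trans (≈-sym (%-≈ c)) (≈-reflexive (cong +_ c%p≡0)))
    square≈ : ∀ x → + x * + x ≈ + ((x ℕ.* x) % p)
    square≈ x = ≈-trans (≈-reflexive (≡.sym (ℤ.pos-* x x))) (≈-sym (%-≈ (x ℕ.* x)))
    hit⇒square≈c : ∀ {x} → T (hits x) → + x * + x ≈ + c
    hit⇒square≈c {x} hit = ≈-trans (square≈ x) (≈-trans (≈-reflexive (cong +_ (ℕ.≡ᵇ⇒≡ _ _ hit))) (%-≈ c))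
    by-cases : Dec (T (any hits (upTo p))) → (if any hits (upTo p) then + 1 else -1ℤ) ≈ (+ c) ^ h
    by-cases (yes found) with x , hit ← Any.satisfied (any⁻ hits (upTo p) found) =
      ≈-trans (≈-reflexive (if-T found)) (≈-sym (≈-trans (^-cong h (≈-sym x²≈c)) (euler-residue x x≉0)))
      where
      x²≈c : + x * + x ≈ + c
      x²≈c = hit⇒square≈c {x} hit
      x≉0 : + x ≉ + 0
      x≉0 x≈0 = c≉0 (≈-trans (≈-sym x²≈c) (≈-trans (*-congˡ (+ x) x≈0) (≈-reflexive (ℤ.*-zeroʳ (+ x)))))
    by-cases (no none) = ≈-trans (≈-reflexive (if-¬T none)) (≈-sym (euler-nonresidue c c≉0 nonresidue))
      where
      nonresidue : ∀ x → + x * + x ≉ + c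
      nonresidue x x²≈c = none (any⁺ hits (lose (∈-upTo⁺ (DivMod.m%n<n x p)) hit))
        where
        r = x % p
        hit : T (hits r)
        hit = ℕ.≡⇒≡ᵇ _ _ (residue-injective (DivMod.m%n<n (r ℕ.* r) p) (DivMod.m%n<n c p) (begin
          + ((r ℕ.* r) % p) ≈⟨ ≈-sym (square≈ r) ⟩
          + r * + r         ≈⟨ *-cong (%-≈ x) (%-≈ x) ⟩
          + x * + x         ≈⟨ x²≈c ⟩
          + c               ≈⟨ ≈-sym (%-≈ c) ⟩
          + (c % p)         ∎))

  private
    upper-half : ∀ x → 1 ≤ x → x ≤ h → -1ℤ * + (suc h ∸ x) ≈ + (h + x)
    upper-half x _ x≤h = ≈-sym (-≈0⇒≈ (begin
        + (h + x) - -1ℤ * + (suc h ∸ x) ≡⟨ cong (λ z → + (h + x) - z) (ℤ.-1*i≡-i (+ (suc h ∸ x))) ⟩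
        + (h + x) - - + (suc h ∸ x)     ≡⟨ cong (λ z → + (h + x) ℤ.+ z) (ℤ.neg-involutive (+ (suc h ∸ x))) ⟩
        + (h + x) ℤ.+ + (suc h ∸ x)     ≡⟨ ≡.sym (ℤ.pos-+ (h + x) _) ⟩
        + (h + x + (suc h ∸ x))         ≡⟨ cong +_ sum≡p ⟩
        + p                             ≈⟨ p≈0 ⟩
        + 0                             ∎))
        where
        sum≡p : h + x + (suc h ∸ x) ≡ p
        sum≡p = ≡.trans (ℕ.+-assoc h x _) (≡.trans (cong (λ z → h + z) (ℕ.m+[n∸m]≡n (ℕ.m≤n⇒m≤1+n x≤h))) (ℕ.+-suc h h))

  half-factorial-square : -1ℤ ^ h * (factorial h * factorial h) ≈ -1ℤ
  half-factorial-square = begin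
    -1ℤ ^ h * (t * t)                                 ≡⟨ rotate (-1ℤ ^ h) t t ⟩
    t * (-1ℤ ^ h * t)                                 ≡⟨ cong (λ z → t * (z * t)) (≡.sym (Π-const h -1ℤ)) ⟩
    t * (Π h (λ _ → -1ℤ) * t)                         ≈⟨ *-congˡ t (*-congˡ (Π h (λ _ → -1ℤ)) (≈-sym (Π-reverse h (λ x → + x)))) ⟩
    t * (Π h (λ _ → -1ℤ) * Π h (λ x → + (suc h ∸ x))) ≈⟨ *-congˡ t (≈-sym (Π-distrib h _ _)) ⟩
    t * Π h (λ x → -1ℤ * + (suc h ∸ x))               ≈⟨ *-congˡ t (Π-cong h upper-half) ⟩
    t * Π h (λ x → + (h + x))                         ≈⟨ ≈-sym (Π-+ h h (λ x → + x)) ⟩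
    factorial (h + h)                                 ≈⟨ wilson ⟩
    -1ℤ                                               ∎
    where
    t = factorial h
    rotate : ∀ s t u → s * (t * u) ≡ t * (s * u)
    rotate = solve-∀

  halfReciprocal : ℕ → ℕ → ℕ
  halfReciprocal c x = tilde p (reciprocal c x)

  *-halfReciprocal : ∀ c x → + x ≉ + 0 → + x * + halfReciprocal c x ≈± + c
  *-halfReciprocal c x x≉0 =
    ≈±-trans (≈±-*-congˡ (+ x) (tilde-≈± (reciprocal c x))) (≈⇒≈± (*-reciprocal c x x≉0))

  halfReciprocal-involution : ∀ c → + c ≉ + 0 → IsInvolutionOn h (halfReciprocal c)
  halfReciprocal-involution c c≉0 = record
    { closed = λ x 1≤x x≤h →
        tilde-positive (reciprocal c x) (reciprocal-≉0 c x c≉0 (half-unit 1≤x x≤h)) , tilde-≤ (reciprocal c x)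
    ; involutive = λ x 1≤x x≤h →
        let u = halfReciprocal c x
            u≉0 = half-unit (tilde-positive (reciprocal c x) (reciprocal-≉0 c x c≉0 (half-unit 1≤x x≤h))) (tilde-≤ (reciprocal c x))
        in tilde-unique (reciprocal c u) x≤h (*-cancelˡ-≈± u≉0 (≈±-trans (≈⇒≈± (*-reciprocal c u u≉0))
             (≈±-sym (≈±-trans (≈⇒≈± (≈-reflexive (ℤ.*-comm (+ u) (+ x)))) (*-halfReciprocal c x (half-unit 1≤x x≤h)))))) }

  tilde-*-halfReciprocal : ∀ c y → 1 ≤ y → y ≤ h → tilde p (c ℕ.* y) ≡ halfReciprocal c (halfReciprocal 1 y)
  tilde-*-halfReciprocal c y 1≤y y≤h = tilde-cong (c ℕ.* y) (reciprocal c v)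
    (≈±-sym (*-cancelˡ-≈± v≉0 (≈±-trans (≈⇒≈± (*-reciprocal c v v≉0)) (≈±-sym v*cy≈±c))))
    where
    v = halfReciprocal 1 y
    v≉0 : + v ≉ + 0
    v≉0 = half-unit (proj₁ (IsInvolutionOn.closed (halfReciprocal-involution 1 1≉0) y 1≤y y≤h))
                    (proj₂ (IsInvolutionOn.closed (halfReciprocal-involution 1 1≉0) y 1≤y y≤h))
    v*cy≈±c : + v * + (c ℕ.* y) ≈± + c
    v*cy≈±c = ≈±-trans (≈⇒≈± (≈-reflexive (≡.trans (cong (+ v *_) (ℤ.pos-* c y)) (rotate (+ v) (+ c) (+ y)))))
                (≈±-trans (≈±-*-congˡ (+ c) (*-halfReciprocal 1 y (half-unit 1≤y y≤h))) (≈⇒≈± (≈-reflexive (ℤ.*-identityʳ (+ c)))))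
      where
      rotate : ∀ v c y → v * (c * y) ≡ c * (y * v)
      rotate = solve-∀

  Π-half-system : ∀ c → + c ≉ + 0 → (f : ℕ → ℤ) → Π h (λ y → f (tilde p (c ℕ.* y))) ≈ Π h f
  Π-half-system c c≉0 f = begin
    Π h (λ y → f (tilde p (c ℕ.* y)))                     ≈⟨ Π-cong h (λ y 1≤y y≤h → ≈-reflexive (cong f (tilde-*-halfReciprocal c y 1≤y y≤h))) ⟩
    Π h (λ y → f (halfReciprocal c (halfReciprocal 1 y))) ≈⟨ Π-involution h (halfReciprocal-involution 1 1≉0) _ ⟩
    Π h (λ y → f (halfReciprocal c y))                    ≈⟨ Π-involution h (halfReciprocal-involution c c≉0) f ⟩
    Π h f                                                 ∎

  private
    sign-flip : ∀ s → s ≤ p → -1ℤ ^ s ≡ - (-1ℤ ^ (p ∸ s))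
    sign-flip s s≤p = ≡.trans (-1ℤ^m≡-1ℤ^n*-1ℤ^[n∸m] s≤p) (≡.trans (cong (λ z → -1ℤ * z * -1ℤ ^ (p ∸ s)) (-1ℤ^[n+n]≡1 h)) (ℤ.-1*i≡-i _))

  signed-tilde : ∀ s → s < p → signed s ≈ signed (tilde p s)
  signed-tilde s s<p with p ℕ.<? 2 ℕ.* (s % p)
  ... | yes p<2r rewrite if-< {x = p ∸ s % p} {s % p} p<2r | DivMod.m<n⇒m%n≡m s<p = begin
    -1ℤ ^ s * + s               ≡⟨ cong (_* + s) (sign-flip s (ℕ.<⇒≤ s<p)) ⟩
    - (-1ℤ ^ (p ∸ s)) * + s     ≡⟨ neg-swap (-1ℤ ^ (p ∸ s)) (+ s) ⟩
    -1ℤ ^ (p ∸ s) * (+ 0 - + s) ≈⟨ *-congˡ (-1ℤ ^ (p ∸ s)) (+-cong (≈-sym p≈0) (≈-refl { - + s})) ⟩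
    -1ℤ ^ (p ∸ s) * (+ p - + s) ≡⟨ cong (-1ℤ ^ (p ∸ s) *_) (≡.sym (pos-∸ (ℕ.<⇒≤ s<p))) ⟩
    -1ℤ ^ (p ∸ s) * + (p ∸ s)   ∎
    where
    neg-swap : ∀ a b → - a * b ≡ a * (+ 0 - b)
    neg-swap = solve-∀
  ... | no p≮2r rewrite if-≮ {x = p ∸ s % p} {s % p} p≮2r | DivMod.m<n⇒m%n≡m s<p = ≈-refl

  gauss : (+ 2) ^ h * factorial h ≈ Π h signed
  gauss = begin
    (+ 2) ^ h * factorial h                ≡⟨ cong (_* factorial h) (≡.sym (Π-const h (+ 2))) ⟩
    Π h (λ _ → + 2) * factorial h          ≈⟨ ≈-sym (Π-distrib h _ _) ⟩
    Π h (λ x → + 2 * + x)                  ≈⟨ Π-cong h doubled ⟩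
    Π h (λ x → signed (tilde p (2 ℕ.* x))) ≈⟨ Π-half-system 2 2≉0 signed ⟩
    Π h signed                             ∎
    where
    doubled : ∀ x → 1 ≤ x → x ≤ h → + 2 * + x ≈ signed (tilde p (2 ℕ.* x))
    doubled x _ x≤h = ≈-trans (≈-reflexive (≡.trans (≡.sym (ℤ.*-identityˡ (+ 2 * + x)))
        (≡.cong₂ _*_ (≡.sym (≡.trans (cong (-1ℤ ^_) (double x)) (-1ℤ^[n+n]≡1 x))) (≡.sym (ℤ.pos-* 2 x)))))
      (signed-tilde (2 ℕ.* x) (≡.subst (_< p) (≡.sym (double x)) (s≤s (ℕ.+-mono-≤ x≤h x≤h))))

  +-Π : ∀ n (g : ℕ → ℕ) → + RangeProduct.Π ℕ.*-1-commutativeMonoid n g ≡ Π n (λ x → + g x)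
  +-Π zero g = refl
  +-Π (suc n) g = ≡.trans (ℤ.pos-* (g (suc n)) _) (cong (+ g (suc n) *_) (+-Π n g))

module OneModFour (m : ℕ) (p-prime : Prime (suc ((m ℕ.+ m) ℕ.+ (m ℕ.+ m)))) where

  open import Data.Nat using (_+_)
  open import Data.List using (map; concatMap)
  open import Data.Nat.ListAction using (product)
  open OddPrime (m + m) p-prime
  open ListProduct
  module ℕΠ = RangeProduct ℕ.*-1-commutativeMonoid
  import Data.List.Properties as List
  module ≈-Reasoning = Relation.Binary.Reasoning.Setoid setoid

  h : ℕ
  h = m + m

  half≡h : half p ≡ h
  half≡h = ≡.trans (cong (ℕ._/ 2) (≡.trans (cong (λ z → h + z) (≡.sym (ℕ.+-identityʳ h))) (ℕ.*-comm 2 h))) (DivMod.m*n/n≡m h 2)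

  tval≡factorial : + tval p ≡ factorial h
  tval≡factorial =
    ≡.trans (cong (λ n → + product (range1 n)) half≡h)
      (≡.trans (cong (λ xs → + product xs) (≡.sym (List.map-id (range1 h))))
        (≡.trans (cong +_ (product-range1 (λ x → x) h)) (+-Π h (λ x → x))))

  t : ℤ
  t = + tval p

  t*t≈-1 : t * t ≈ -1ℤ
  t*t≈-1 = begin
    t * t                                 ≡⟨ ≡.cong₂ _*_ tval≡factorial tval≡factorial ⟩
    factorial h * factorial h             ≡⟨ ≡.sym (≡.trans (cong (_* (factorial h * factorial h)) (-1ℤ^[n+n]≡1 m)) (ℤ.*-identityˡ _)) ⟩
    -1ℤ ^ h * (factorial h * factorial h) ≈⟨ half-factorial-square ⟩
    -1ℤ                                   ∎
    where open ≈-Reasoning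

  t≉0 : t ≉ + 0
  t≉0 t≈0 = -1≉0 (≈-trans (≈-sym t*t≈-1) (≈-trans (*-congˡ t t≈0) (≈-reflexive (ℤ.*-zeroʳ t))))

  private
    t*-≉0 : ∀ {a} → 1 ≤ a → a ≤ h → + (tval p ℕ.* a) ≉ + 0
    t*-≉0 {a} 1≤a a≤h = ≡.subst (_≉ + 0) (≡.sym (ℤ.pos-* (tval p) a)) (*-≉0 t≉0 (half-unit 1≤a a≤h))

  bar≈± : ∀ a → + bar p a ≈± t * + a
  bar≈± a = ≈±-trans (tilde-≈± (tval p ℕ.* a)) (≈⇒≈± (≈-reflexive (ℤ.pos-* (tval p) a)))

  t*t*a≈-a : ∀ a → t * (t * a) ≈ - a
  t*t*a≈-a a = begin
    t * (t * a) ≡⟨ ≡.sym (ℤ.*-assoc t t a) ⟩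
    t * t * a   ≈⟨ *-congʳ a t*t≈-1 ⟩
    -1ℤ * a     ≡⟨ ℤ.-1*i≡-i a ⟩
    - a         ∎
    where open ≈-Reasoning

  bar-involution : IsInvolutionOn h (bar p)
  bar-involution = record
    { closed = λ a 1≤a a≤h → tilde-positive (tval p ℕ.* a) (t*-≉0 1≤a a≤h) , tilde-≤ (tval p ℕ.* a)
    ; involutive = λ a 1≤a a≤h → tilde-unique (tval p ℕ.* bar p a) a≤h
        (≈±-trans (≈⇒≈± (≈-reflexive (ℤ.pos-* (tval p) (bar p a))))
          (≈±-trans (≈±-*-congˡ t (bar≈± a)) (inj₂ (t*t*a≈-a (+ a))))) }

  bar-no-fixed-point : ∀ a → 1 ≤ a → a ≤ h → a ≢ bar p a
  bar-no-fixed-point a 1≤a a≤h a≡ā = *-≉0 2≉0 (*-≉0 a≉0 a≉0) (begin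
    + 2 * (+ a * + a)         ≡⟨ twice (+ a * + a) ⟩
    + a * + a - - (+ a * + a) ≈⟨ +-cong (≈-refl {+ a * + a}) (-‿cong (≈-sym a²≈-a²)) ⟩
    + a * + a - + a * + a     ≡⟨ ℤ.+-inverseʳ (+ a * + a) ⟩
    + 0                       ∎)
    where
    open ≈-Reasoning
    a≉0 = half-unit 1≤a a≤h
    twice : ∀ x → + 2 * x ≡ x - - x
    twice = solve-∀
    a²≈-a² : + a * + a ≈ - (+ a * + a)
    a²≈-a² = begin
      + a * + a             ≈⟨ ≈±⇒square≈ (≈±-trans (≈⇒≈± (≈-reflexive (cong +_ a≡ā))) (bar≈± a)) ⟩
      t * + a * (t * + a)   ≡⟨ ℤ.*-assoc t (+ a) _ ⟩
      t * (+ a * (t * + a)) ≡⟨ cong (t *_) (swap (+ a) t (+ a)) ⟩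
      t * (t * (+ a * + a)) ≈⟨ t*t*a≈-a (+ a * + a) ⟩
      - (+ a * + a)         ∎
      where
      swap : ∀ x y z → x * (y * z) ≡ y * (x * z)
      swap = solve-∀

  sum-of-squares≈0⇔ : ∀ i j → i ≤ h → + (i ℕ.* i + j ℕ.* j) ≈ + 0 ⇔ i ≡ bar p j
  sum-of-squares≈0⇔ i j i≤h = mk⇔
    (λ sum≈0 → ≡.sym (tilde-unique (tval p ℕ.* j) i≤h (≈±-sym (≈±-trans (square-root (+ i) (t * + j) (i²≈ sum≈0))
                  (≈⇒≈± (≈-reflexive (≡.sym (ℤ.pos-* (tval p) j))))))))
    (λ i≡ā → begin
      + (i ℕ.* i + j ℕ.* j)             ≡⟨ expand ⟩
      + i * + i ℤ.+ + j * + j           ≈⟨ +-cong (≈±⇒square≈ (≈±-trans (≈⇒≈± (≈-reflexive (cong +_ i≡ā))) (bar≈± j))) (≈-refl {+ j * + j}) ⟩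
      t * + j * (t * + j) ℤ.+ + j * + j ≈⟨ +-cong (≈-sym -j²≈) (≈-refl {+ j * + j}) ⟩
      - (+ j * + j) ℤ.+ + j * + j       ≡⟨ ℤ.+-inverseˡ (+ j * + j) ⟩
      + 0                               ∎)
    where
    open ≈-Reasoning
    expand : + (i ℕ.* i + j ℕ.* j) ≡ + i * + i ℤ.+ + j * + j
    expand = ≡.trans (ℤ.pos-+ (i ℕ.* i) (j ℕ.* j)) (≡.cong₂ ℤ._+_ (ℤ.pos-* i i) (ℤ.pos-* j j))
    -j²≈ : - (+ j * + j) ≈ t * + j * (t * + j)
    -j²≈ = ≈-sym (≈-trans (≈-reflexive (≡.trans (ℤ.*-assoc t (+ j) _) (cong (t *_) (swap (+ j) t (+ j))))) (t*t*a≈-a (+ j * + j)))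
      where
      swap : ∀ x y z → x * (y * z) ≡ y * (x * z)
      swap = solve-∀
    i²≈ : + (i ℕ.* i + j ℕ.* j) ≈ + 0 → + i * + i ≈ t * + j * (t * + j)
    i²≈ sum≈0 = ≈-trans (-≈0⇒≈ (≈-trans (≈-reflexive (≡.trans (rearrange (+ i * + i) (+ j * + j)) (≡.sym expand))) sum≈0)) -j²≈
      where
      rearrange : ∀ x y → x - - y ≡ x ℤ.+ y
      rearrange = solve-∀

  pair-test : ∀ i j → i ≤ h → (((i ℕ.* i + j ℕ.* j) % p) ≡ᵇ 0) ≡ (i ≡ᵇ bar p j)
  pair-test i j i≤h with i ℕ.≟ bar p j
  ... | yes i≡ā = ≡.trans (Equivalence.to T-≡ (ℕ.≡⇒≡ᵇ _ 0 (≈0⇒%≡0 _ (Equivalence.from (sum-of-squares≈0⇔ i j i≤h) i≡ā))))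
                    (≡.sym (Equivalence.to T-≡ (ℕ.≡⇒≡ᵇ i (bar p j) i≡ā)))
  ... | no i≢ā = ≡.trans (¬T⇒≡false (λ hit → i≢ā (Equivalence.to (sum-of-squares≈0⇔ i j i≤h) (%≡0⇒≈0 _ (ℕ.≡ᵇ⇒≡ _ 0 hit)))))
                    (≡.sym (¬T⇒≡false (λ hit → i≢ā (ℕ.≡ᵇ⇒≡ i (bar p j) hit))))

  termAtLarger : ℕ → ℕ
  termAtLarger j = if bar p j <ᵇ j then j ℕ.* j ∸ bar p j ℕ.* bar p j else 1

  termAtSmaller : ℕ → ℕ
  termAtSmaller a = if a <ᵇ bar p a then bar p a ℕ.* bar p a ∸ a ℕ.* a else 1

  private
    pair? : ℕ × ℕ → Bool
    pair? (i , j) = ((i ℕ.* i + j ℕ.* j) % p) ≡ᵇ 0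

    kept-difference : ℕ × ℕ → ℕ
    kept-difference (i , j) = if pair? (i , j) then j ℕ.* j ∸ i ℕ.* i else 1

    row : ℕ → List (ℕ × ℕ)
    row j = map (λ i → (i , j)) (range1 (j ∸ 1))

    rowProduct : ℕ → ℕ
    rowProduct j = product (map kept-difference (row j))

  row-product : ∀ j → 1 ≤ j → j ≤ h → rowProduct j ≡ termAtLarger j
  row-product (suc j) _ 1+j≤h = begin
    product (map kept-difference (map (λ i → (i , suc j)) (range1 j))) ≡⟨ product-map-map kept-difference _ (range1 j) ⟩
    product (map (λ i → kept-difference (i , suc j)) (range1 j))       ≡⟨ product-range1 _ j ⟩
    ℕΠ.Π j (λ i → kept-difference (i , suc j))                         ≡⟨ ℕΠ.Π-cong j only-partner ⟩
    ℕΠ.Π j (λ i → if i ≡ᵇ ā then difference else 1)                    ≡⟨ ℕΠ.Π-single j ā difference 1≤ā ⟩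
    termAtLarger (suc j)                                               ∎
    where
    open ≡.≡-Reasoning
    ā = bar p (suc j)
    difference = suc j ℕ.* suc j ∸ ā ℕ.* ā
    1≤ā = proj₁ (IsInvolutionOn.closed bar-involution (suc j) (s≤s z≤n) 1+j≤h)
    only-partner : ∀ i → 1 ≤ i → i ≤ j → kept-difference (i , suc j) ≡ (if i ≡ᵇ ā then difference else 1)
    only-partner i _ i≤j rewrite pair-test i (suc j) (ℕ.≤-trans (ℕ.m≤n⇒m≤1+n i≤j) 1+j≤h) with i ℕ.≟ ā
    ... | yes refl = ≡.trans (if-≡ᵇ-refl i) (≡.sym (if-≡ᵇ-refl i))
    ... | no i≢ā = ≡.trans (if-≢ i≢ā) (≡.sym (if-≢ i≢ā))

  prodPairs≡Π : prodPairs p ≡ ℕΠ.Π h termAtLarger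
  prodPairs≡Π = begin
    prodPairs p                                                     ≡⟨ product-filterᵇ pair? _ (concatMap row (range1 (half p))) ⟩
    product (map kept-difference (concatMap row (range1 (half p)))) ≡⟨ product-concatMap kept-difference row (range1 (half p)) ⟩
    product (map rowProduct (range1 (half p)))                      ≡⟨ cong (λ n → product (map rowProduct (range1 n))) half≡h ⟩
    product (map rowProduct (range1 h))                             ≡⟨ product-range1 rowProduct h ⟩
    ℕΠ.Π h rowProduct                                               ≡⟨ ℕΠ.Π-cong h row-product ⟩
    ℕΠ.Π h termAtLarger                                             ∎
    where open ≡.≡-Reasoning

  prodV≡Π : prodV p ≡ ℕΠ.Π h termAtSmaller
  prodV≡Π = begin
    prodV p                                       ≡⟨ product-filterᵇ (λ x → x <ᵇ tilde p (tval p ℕ.* x)) _ (range1 (half p)) ⟩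
    product (map termAtSmaller (range1 (half p))) ≡⟨ cong (λ n → product (map termAtSmaller (range1 n))) half≡h ⟩
    product (map termAtSmaller (range1 h))        ≡⟨ product-range1 termAtSmaller h ⟩
    ℕΠ.Π h termAtSmaller                          ∎
    where open ≡.≡-Reasoning

  prodPairs≡prodV : prodPairs p ≡ prodV p
  prodPairs≡prodV = begin
    prodPairs p                           ≡⟨ prodPairs≡Π ⟩
    ℕΠ.Π h termAtLarger                   ≡⟨ ≡.sym (ℕΠ.Π-involution h bar-involution termAtLarger) ⟩
    ℕΠ.Π h (λ a → termAtLarger (bar p a)) ≡⟨ ℕΠ.Π-cong h larger-partner ⟩
    ℕΠ.Π h termAtSmaller                  ≡⟨ ≡.sym prodV≡Π ⟩
    prodV p                               ∎
    where
    open ≡.≡-Reasoning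
    larger-partner : ∀ a → 1 ≤ a → a ≤ h → termAtLarger (bar p a) ≡ termAtSmaller a
    larger-partner a 1≤a a≤h = cong (λ x → if x <ᵇ bar p a then bar p a ℕ.* bar p a ∸ x ℕ.* x else 1)
                                    (IsInvolutionOn.involutive bar-involution a 1≤a a≤h)

  φ : ℕ → ℕ
  φ y = tilde p (suc (tval p) ℕ.* y)

  1+t≉0 : + suc (tval p) ≉ + 0
  1+t≉0 1+t≈0 = 1≉-1 (≈-trans (≈-sym (*-cong t≈-1 t≈-1)) t*t≈-1)
    where
    t≈-1 : t ≈ -1ℤ
    t≈-1 = -≈0⇒≈ (≈-trans (≈-reflexive (≡.trans (ℤ.+-comm t (+ 1)) (≡.sym (ℤ.pos-+ 1 (tval p))))) 1+t≈0)

  private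
    [1+t]*≡ : ∀ y → + (suc (tval p) ℕ.* y) ≡ + y ℤ.+ t * + y
    [1+t]*≡ y = ≡.trans (ℤ.pos-* (suc (tval p)) y) (≡.trans (cong (_* + y) (ℤ.pos-+ 1 (tval p))) (distrib t (+ y)))
      where
      distrib : ∀ t y → (+ 1 ℤ.+ t) * y ≡ y ℤ.+ t * y
      distrib = solve-∀

  φ-pair : ∀ a → a < bar p a → a ≤ h →
    (φ a ≡ tilde p (bar p a + a) × φ (bar p a) ≡ bar p a ∸ a) ⊎ (φ a ≡ bar p a ∸ a × φ (bar p a) ≡ tilde p (bar p a + a))
  φ-pair a a<b a≤h with bar≈± a
  ... | inj₁ b≈ta = inj₁ (tilde-cong _ (b + a) (≈⇒≈± (begin
        + (suc (tval p) ℕ.* a) ≡⟨ [1+t]*≡ a ⟩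
        + a ℤ.+ t * + a        ≈⟨ +-cong (≈-refl {+ a}) (≈-sym b≈ta) ⟩
        + a ℤ.+ + b            ≡⟨ ≡.trans (ℤ.+-comm (+ a) (+ b)) (≡.sym (ℤ.pos-+ b a)) ⟩
        + (b + a)              ∎))
      , tilde-unique _ (ℕ.≤-trans (ℕ.m∸n≤m b a) b≤h) (≈⇒≈± (begin
        + (suc (tval p) ℕ.* b) ≡⟨ [1+t]*≡ b ⟩
        + b ℤ.+ t * + b        ≈⟨ +-cong (≈-refl {+ b}) (*-congˡ t b≈ta) ⟩
        + b ℤ.+ t * (t * + a)  ≈⟨ +-cong (≈-refl {+ b}) (t*t*a≈-a (+ a)) ⟩
        + b - + a              ≡⟨ ≡.sym (pos-∸ (ℕ.<⇒≤ a<b)) ⟩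
        + (b ∸ a)              ∎)))
    where
    open ≈-Reasoning
    b = bar p a
    b≤h = tilde-≤ (tval p ℕ.* a)
  ... | inj₂ b≈-ta = inj₂ (tilde-unique _ (ℕ.≤-trans (ℕ.m∸n≤m b a) b≤h) (inj₂ (begin
        + (suc (tval p) ℕ.* a) ≡⟨ [1+t]*≡ a ⟩
        + a ℤ.+ t * + a        ≈⟨ +-cong (≈-refl {+ a}) (≈-trans (≈-reflexive (≡.sym (ℤ.neg-involutive (t * + a)))) (-‿cong (≈-sym b≈-ta))) ⟩
        + a - + b              ≡⟨ ≡.trans (negate (+ b) (+ a)) (cong -_ (≡.sym (pos-∸ (ℕ.<⇒≤ a<b)))) ⟩
        - + (b ∸ a)            ∎))
      , tilde-cong _ (b + a) (≈⇒≈± (begin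
        + (suc (tval p) ℕ.* b)  ≡⟨ [1+t]*≡ b ⟩
        + b ℤ.+ t * + b         ≈⟨ +-cong (≈-refl {+ b}) (*-congˡ t b≈-ta) ⟩
        + b ℤ.+ t * - (t * + a) ≡⟨ cong (λ z → + b ℤ.+ z) (≡.sym (ℤ.neg-distribʳ-* t (t * + a))) ⟩
        + b - t * (t * + a)     ≈⟨ +-cong (≈-refl {+ b}) (-‿cong (t*t*a≈-a (+ a))) ⟩
        + b - - + a             ≡⟨ cong (λ z → + b ℤ.+ z) (ℤ.neg-involutive (+ a)) ⟩
        + b ℤ.+ + a             ≡⟨ ≡.sym (ℤ.pos-+ b a) ⟩
        + (b + a)               ∎)))
    where
    open ≈-Reasoning
    b = bar p a
    b≤h = tilde-≤ (tval p ℕ.* a)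
    negate : ∀ b a → a - b ≡ - (b - a)
    negate = solve-∀

  difference-of-squares≈ : ∀ a → a < bar p a → a ≤ h →
    + (bar p a ℕ.* bar p a ∸ a ℕ.* a) ≈ signed (φ a) * signed (φ (bar p a))
  difference-of-squares≈ a a<b a≤h = begin
    + (b ℕ.* b ∸ a ℕ.* a)                     ≡⟨ signed-difference-of-squares (ℕ.<⇒≤ a<b) ⟩
    signed (b ∸ a) * signed (b + a)           ≈⟨ *-congˡ (signed (b ∸ a)) (signed-tilde (b + a) (s≤s (ℕ.+-mono-≤ b≤h (ℕ.≤-trans (ℕ.<⇒≤ a<b) b≤h)))) ⟩
    signed (b ∸ a) * signed (tilde p (b + a)) ≡⟨ in-some-order (φ-pair a a<b a≤h) ⟩
    signed (φ a) * signed (φ b)               ∎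
    where
    open ≈-Reasoning
    b = bar p a
    b≤h = tilde-≤ (tval p ℕ.* a)
    in-some-order : (φ a ≡ tilde p (b + a) × φ b ≡ b ∸ a) ⊎ (φ a ≡ b ∸ a × φ b ≡ tilde p (b + a)) →
                    signed (b ∸ a) * signed (tilde p (b + a)) ≡ signed (φ a) * signed (φ b)
    in-some-order (inj₁ (φa≡ , φb≡)) = ≡.trans (ℤ.*-comm (signed (b ∸ a)) (signed (tilde p (b + a)))) (≡.sym (≡.cong₂ (λ u v → signed u * signed v) φa≡ φb≡))
    in-some-order (inj₂ (φa≡ , φb≡)) = ≡.sym (≡.cong₂ (λ u v → signed u * signed v) φa≡ φb≡)

  prodV≈ : + prodV p ≈ legendre 2 p * t
  prodV≈ = begin
    + prodV p                                 ≡⟨ cong +_ prodV≡Π ⟩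
    + ℕΠ.Π h termAtSmaller                    ≡⟨ +-Π h termAtSmaller ⟩
    Π h (λ a → + termAtSmaller a)             ≈⟨ Π-cong h termAtSmaller≈pairUp ⟩
    Π h (pairUp (bar p) (λ y → signed (φ y))) ≈⟨ ≈-sym (Π-pairUp h bar-involution (λ y → signed (φ y))) ⟩
    Π h (λ y → signed (φ y))                  ≈⟨ Π-half-system (suc (tval p)) 1+t≉0 signed ⟩
    Π h signed                                ≈⟨ ≈-sym gauss ⟩
    (+ 2) ^ h * factorial h                   ≈⟨ *-cong (≈-sym (legendre≈power 2 2≉0)) (≈-reflexive (≡.sym tval≡factorial)) ⟩
    legendre 2 p * t                          ∎
    where
    open ≈-Reasoning
    termAtSmaller≈pairUp : ∀ a → 1 ≤ a → a ≤ h → + termAtSmaller a ≈ pairUp (bar p) (λ y → signed (φ y)) a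
    termAtSmaller≈pairUp a 1≤a a≤h with ℕ.<-cmp a (bar p a)
    ... | tri< a<ā _ _ = ≈-trans (≈-reflexive (cong +_ (if-< a<ā)))
          (≈-trans (difference-of-squares≈ a a<ā a≤h) (≈-reflexive (≡.sym (pairUp-< (bar p) (λ y → signed (φ y)) a a<ā))))
    ... | tri≈ _ a≡ā _ = ⊥-elim (bar-no-fixed-point a 1≤a a≤h a≡ā)
    ... | tri> a≮ā _ ā<a = ≈-reflexive (≡.trans (cong +_ (if-≮ a≮ā)) (≡.sym (pairUp-> (bar p) (λ y → signed (φ y)) a ā<a)))

  theorem : ((+ prodPairs p) ≡ (+ prodV p) [mod p ]) × ((+ prodV p) ≡ (legendre 2 p * + tval p) [mod p ])
  theorem = toMod (≈-reflexive (cong +_ prodPairs≡prodV)) , toMod prodV≈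

corollary2p6 : (p : ℕ) → .{{_ : NonZero p}} → Prime p → p % 4 ≡ 1 →
    ((+ prodPairs p) ≡ (+ prodV p) [mod p ]) ×
    ((+ prodV p) ≡ (legendre 2 p * + tval p) [mod p ])
corollary2p6 p p-prime p%4≡1 = by-shape (p / 4) p≡4m+1 p-prime
  where
  p≡4m+1 : p ≡ suc ((p / 4 ℕ.+ p / 4) ℕ.+ (p / 4 ℕ.+ p / 4))
  p≡4m+1 = ≡.trans (DivMod.m≡m%n+[m/n]*n p 4) (≡.trans (cong (ℕ._+ p / 4 ℕ.* 4) p%4≡1) (cong suc (four-times (p / 4))))
    where
    four-times : ∀ m → m ℕ.* 4 ≡ (m ℕ.+ m) ℕ.+ (m ℕ.+ m)
    four-times = ℕSolver.solve-∀
  by-shape : ∀ {p} m .{{_ : NonZero p}} → p ≡ suc ((m ℕ.+ m) ℕ.+ (m ℕ.+ m)) → Prime p →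
    ((+ prodPairs p) ≡ (+ prodV p) [mod p ]) × ((+ prodV p) ≡ (legendre 2 p * + tval p) [mod p ])
  by-shape m refl p-prime = OneModFour.theorem m p-prime
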